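{- Let $q\ge5$ be a power of $3$. Then every $\Gamma$-plane contains the axis $\mathrm{A}$ (so $\Lambda_{\mathrm{A},\Gamma}=1$ and $\Pi_{\Gamma,\mathrm{A}}=q+1$), and $\mathrm{A}$ is contained in no $2_{\mathcal C}$-, $3_{\mathcal C}$-, $\overline{1_{\mathcal C}}$- or $0_{\mathcal C}$-plane. Moreover $\Lambda_{\mathrm{EA},\Gamma}=q^2-1$ and $\Pi_{\Gamma,\mathrm{EA}}=1$.
   Context: Let $\mathrm{PG}(3,q)$ have points $\mathbf{P}(x_0,x_1,x_2,x_3)$; put $P(t)=\mathbf{P}(t^3,t^2,t,1)$ ($t\in\mathbb{F}_q$), $P(\infty)=\mathbf{P}(1,0,0,0)$, $\mathcal{C}=\{P(t):t\in\mathbb{F}_q\cup\{\infty\}\}$ the twisted cubic, $G_q$ the group of projectivities fixing $\mathcal C$. Write $\boldsymbol{\pi}(c_0,c_1,c_2,c_3)$ for the plane $c_0x_0+c_1x_1+c_2x_2+c_3x_3=0$. $\Gamma$-planes: the osculating planes $\boldsymbol{\pi}(1,-3t,3t^2,-t^3)$ ($t\in\mathbb{F}_q$) and $\boldsymbol{\pi}(0,0,0,1)$. For $q\equiv0\pmod3$ all $\Gamma$-planes pass through a common line, the axis $\mathrm{A}$. A $d_{\mathcal C}$-plane ($d\in\{0,2,3\}$) contains exactly $d$ points of $\mathcal C$; a $\overline{1_{\mathcal C}}$-plane is a non-$\Gamma$-plane with exactly one point of $\mathcal C$. An EA-line is a line containing no point of $\mathcal C$, different from $\mathrm{A}$, that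 meets $\mathrm{A}$. Notation: $\Lambda_{\lambda,\pi}$ is the number of $\lambda$-lines in a $\pi$-plane; $\Pi_{\pi,\lambda}$ is the average, over all $\lambda$-lines, of the number of $\pi$-planes through the line. -}

module Defs where

open import Level using (Level; _⊔_) renaming (suc to lsuc)
open import Algebra.Bundles using (CommutativeRing)
open import Data.Nat as ℕ using (ℕ)
open import Data.List using (List; length)
open import Data.Nat.ListAction using (sum)
open import Data.List.Relation.Unary.All using (All)
open import Data.List.Relation.Unary.Any using (Any)
open import Data.List.Relation.Unary.AllPairs using (AllPairs)
open import Data.List.Relation.Binary.Pointwise using (Pointwise)
open import Data.Maybe using (Maybe; just; nothing)
open import Data.Product using (Σ; ∃; ∃-syntax; _×_; _,_)
open import Relation.Nullary using (¬_)
open import Relation.Binary.PropositionalEquality using (_≡_)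

record FiniteField (c ℓ : Level) : Set (lsuc (c ⊔ ℓ)) where
  field
    commRing : CommutativeRing c ℓ
  open CommutativeRing commRing public
  field
    1≉0      : ¬ (1# ≈ 0#)
    inverse  : ∀ x → ¬ (x ≈ 0#) → ∃[ y ] (x * y ≈ 1#)
    elements : List Carrier
    complete : ∀ x → Any (x ≈_) elements
    distinct : AllPairs (λ x y → ¬ (x ≈ y)) elements

  order : ℕ
  order = length elements

module _ {a r p : Level} {A : Set a} (_~_ : A → A → Set r) where

  Enumerates : (A → Set p) → List A → Set (a ⊔ r ⊔ p)
  Enumerates P xs =
    All P xs × AllPairs (λ x y → ¬ (x ~ y)) xs × (∀ x → P x → Any (x ~_) xs)

  HasCount : (A → Set p) → ℕ → Set (a ⊔ r ⊔ p)
  HasCount P n = ∃[ xs ] (Enumerates P xs × length xs ≡ n)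

  -- "The average, over all x (up to _~_) satisfying P, of the number f(x)
  --  is the natural number m", where 'Cnt x k' says that f(x) = k.
  -- (Set of such x is nonempty, and Σ f(x) = m · #{x}.)
  AverageIs : ∀ {s} → (A → Set p) → (A → ℕ → Set s) → ℕ → Set (a ⊔ r ⊔ p ⊔ s)
  AverageIs P Cnt m =
    ∃[ xs ] (Enumerates P xs × ¬ (length xs ≡ 0) ×
      ∃[ ns ] (Pointwise Cnt xs ns × sum ns ≡ m ℕ.* length xs))

module Geometry {c ℓ : Level} (F : FiniteField c ℓ) where
  open FiniteField F

  q : ℕ
  q = order

  -- vectors of F^4 (homogeneous coordinates of points, or plane coefficients)
  record V4 : Set c where
    constructor v4
    field x0 x1 x2 x3 : Carrier
  open V4 public

  _≈v_ : V4 → V4 → Set ℓ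
  u ≈v w = (x0 u ≈ x0 w) × (x1 u ≈ x1 w) × (x2 u ≈ x2 w) × (x3 u ≈ x3 w)

  zeroV : V4
  zeroV = v4 0# 0# 0# 0#

  NonZeroV : V4 → Set ℓ
  NonZeroV u = ¬ (u ≈v zeroV)

  _·_ : Carrier → V4 → V4
  a · u = v4 (a * x0 u) (a * x1 u) (a * x2 u) (a * x3 u)

  _⊕_ : V4 → V4 → V4
  u ⊕ w = v4 (x0 u + x0 w) (x1 u + x1 w) (x2 u + x2 w) (x3 u + x3 w)

  _∼_ : V4 → V4 → Set (c ⊔ ℓ)
  u ∼ w = ∃[ a ] (w ≈v (a · u))

  _∈π_ : V4 → V4 → Set ℓ
  u ∈π cf = (x0 cf * x0 u + x1 cf * x1 u + x2 cf * x2 u + x3 cf * x3 u) ≈ 0#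

  IsPoint IsPlane : V4 → Set ℓ
  IsPoint = NonZeroV
  IsPlane = NonZeroV

  -- Lines: pairs of linearly independent vectors; the line is the set of
  -- points in their span.
  LinePair : Set c
  LinePair = V4 × V4

  Independent : V4 → V4 → Set (c ⊔ ℓ)
  Independent u w = ∀ a b → ((a · u) ⊕ (b · w)) ≈v zeroV → (a ≈ 0#) × (b ≈ 0#)

  IsLine : LinePair → Set (c ⊔ ℓ)
  IsLine (u , w) = Independent u w

  _∈ℓ_ : V4 → LinePair → Set (c ⊔ ℓ)
  x ∈ℓ (u , w) = ∃[ a ] ∃[ b ] (x ≈v ((a · u) ⊕ (b · w)))

  _≗ℓ_ : LinePair → LinePair → Set (c ⊔ ℓ)
  (u , w) ≗ℓ (u' , w') =
    (u' ∈ℓ (u , w)) × (w' ∈ℓ (u , w)) × (u ∈ℓ (u' , w')) × (w ∈ℓ (u' , w'))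

  _⊆π_ : LinePair → V4 → Set ℓ
  (u , w) ⊆π cf = (u ∈π cf) × (w ∈π cf)

  3# : Carrier
  3# = 1# + 1# + 1#

  -- parameters t ∈ F ∪ {∞}  (nothing = ∞)
  Param : Set c
  Param = Maybe Carrier

  P : Param → V4
  P (just t) = v4 (t * t * t) (t * t) t 1#
  P nothing  = v4 1# 0# 0# 0#

  OnC : V4 → Set (c ⊔ ℓ)
  OnC x = ∃[ t ] (P t ∼ x)

  -- the Γ-planes: osculating planes π(1,-3t,3t^2,-t^3) and π(0,0,0,1)
  Osc : Param → V4
  Osc (just t) = v4 1# (- (3# * t)) (3# * (t * t)) (- (t * t * t))
  Osc nothing  = v4 0# 0# 0# 1#

  IsΓ : V4 → Set (c ⊔ ℓ)
  IsΓ cf = IsPlane cf × ∃[ t ] (Osc t ∼ cf)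

  CPointCount : V4 → ℕ → Set (c ⊔ ℓ)
  CPointCount cf d = HasCount _∼_ (λ x → IsPoint x × OnC x × (x ∈π cf)) d

  IsdC : ℕ → V4 → Set (c ⊔ ℓ)
  IsdC d cf = IsPlane cf × CPointCount cf d

  Is1barC : V4 → Set (c ⊔ ℓ)
  Is1barC cf = IsPlane cf × ¬ IsΓ cf × CPointCount cf 1

  -- The axis A (q ≡ 0 mod 3): the line x0 = x3 = 0, spanned by
  -- P(0,1,0,0) and P(0,0,1,0).
  axis : LinePair
  axis = (v4 0# 1# 0# 0# , v4 0# 0# 1# 0#)

  IsALine : LinePair → Set (c ⊔ ℓ)
  IsALine L = IsLine L × (L ≗ℓ axis)

  IsEALine : LinePair → Set (c ⊔ ℓ)
  IsEALine L = IsLine L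
             × (∀ x → IsPoint x → OnC x → ¬ (x ∈ℓ L))
             × ¬ (L ≗ℓ axis)
             × ∃[ x ] (IsPoint x × (x ∈ℓ L) × (x ∈ℓ axis))

  LinesInPlane : (LinePair → Set (c ⊔ ℓ)) → V4 → ℕ → Set (c ⊔ ℓ)
  LinesInPlane Λ cf n = HasCount _≗ℓ_ (λ L → Λ L × (L ⊆π cf)) n

  ΓPlanesThrough : LinePair → ℕ → Set (c ⊔ ℓ)
  ΓPlanesThrough L n = HasCount _∼_ (λ cf → IsΓ cf × (L ⊆π cf)) n

  ΠΓ : (LinePair → Set (c ⊔ ℓ)) → ℕ → Set (c ⊔ ℓ)
  ΠΓ Λ m = AverageIs _≗ℓ_ Λ ΓPlanesThrough m

module Submission where

-- In characteristic 3 the osculating plane π(1, -3t, 3t², -t³) is x₀ = t³x₃, so, cubing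
-- being a bijection of F ((x - y)³ = x³ - y³), the Γ-planes are exactly the planes
-- c₀x₀ + c₃x₃ = 0 through the axis x₀ = x₃ = 0. Such a plane meets C only where
-- c₀t³ + c₃ = 0, i.e. in exactly one point, which rules out the 0_C-, 2_C-, 3_C- and
-- \overline{1_C}-cases. The EA-lines of the Γ-plane at t are its lines other than the
-- axis that miss P(t); in coordinates on the plane each is fixed by its point
-- (1 : m : 0) or (0 : 1 : 0) on the axis and a nonzero shift e of P(t), which gives
-- q(q - 1) + (q - 1) = q² - 1 of them. An EA-line and the axis span a single Γ-plane,
-- whereas the axis lies in all q + 1. Characteristic 3 comes from q = 3^k: translation
-- by 1 permutes F, so summing over F gives q·1 = 0.

open import Level using (Level; _⊔_) renaming (zero to 0ℓ)
open import Algebra.Bundles using (CommutativeMonoid; RawRing)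
open import Algebra.Solver.Ring.AlmostCommutativeRing using (fromCommutativeRing; _-Raw-AlmostCommutative⟶_)
import Algebra.Solver.Ring as RingSolver
open import Data.Empty using (⊥-elim)
open import Function using (_∘′_)
open import Data.List using (List; []; _∷_; length; map; foldr; concat; _++_)
import Data.List.Properties as List
open import Data.List.Relation.Binary.Pointwise using (Pointwise; []; _∷_)
open import Data.List.Relation.Unary.All as All using (All; []; _∷_)
import Data.List.Relation.Unary.All.Properties as Allₚ
open import Data.List.Relation.Unary.AllPairs as AllPairs using (AllPairs; []; _∷_)
import Data.List.Relation.Unary.AllPairs.Properties as AllPairsₚ
open import Data.List.Relation.Unary.Any as Any using (Any; here; there; _─_)
import Data.List.Relation.Unary.Any.Properties as Anyₚ
open import Data.Maybe using (Maybe; just; nothing)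
open import Data.Maybe.Relation.Binary.Pointwise as Maybe using (just; nothing)
open import Data.Nat as ℕ using (ℕ; z≤n; s≤s)
open import Data.Nat.ListAction using (sum)
import Data.Nat.Properties as ℕₚ
open import Data.Product using (∃-syntax; _×_; _,_; proj₁; proj₂; map₂)
open import Data.Sum using (_⊎_; inj₁; inj₂)
open import Relation.Binary.Bundles using (Setoid)
open import Relation.Binary.Definitions using (Decidable)
open import Relation.Binary.PropositionalEquality as ≡ using (_≡_)
open import Relation.Nullary using (¬_; Dec; yes; no)
open import Relation.Unary using (Pred)
open import Defs

length-concat-map : ∀ {a b} {A : Set a} {B : Set b} (f : A → List B) {k} →
                    (∀ x → length (f x) ≡ k) → ∀ xs → length (concat (map f xs)) ≡ length xs ℕ.* k
length-concat-map f |f|≡k []       = ≡.refl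
length-concat-map f |f|≡k (x ∷ xs) =
  ≡.trans (List.length-++ (f x)) (≡.cong₂ ℕ._+_ (|f|≡k x) (length-concat-map f |f|≡k xs))

module UniqueLists {a ℓ} (S : Setoid a ℓ) where
  open Setoid S renaming (Carrier to A)
  open import Data.List.Membership.Setoid S using (_∈_)
  open import Data.List.Relation.Unary.Unique.Setoid S using (Unique)

  ≈-decidable-on : ∀ {xs x y} → Unique xs → x ∈ xs → y ∈ xs → Dec (x ≈ y)
  ≈-decidable-on _ (here x≈z) (here y≈z) = yes (trans x≈z (sym y≈z))
  ≈-decidable-on (z≉ ∷ _) (here x≈z) (there y∈) with All.lookupAny z≉ y∈
  ... | z≉w , y≈w = no λ x≈y → z≉w (trans (sym x≈z) (trans x≈y y≈w))
  ≈-decidable-on (z≉ ∷ _) (there x∈) (here y≈z) with All.lookupAny z≉ x∈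
  ... | z≉w , x≈w = no λ x≈y → z≉w (trans (sym y≈z) (trans (sym x≈y) x≈w))
  ≈-decidable-on (_ ∷ u) (there x∈) (there y∈) = ≈-decidable-on u x∈ y∈

  module _ {p} {P : Pred A p} where

    Unique-─ : ∀ {xs} (i : Any P xs) → Unique xs → Unique (xs ─ i)
    Unique-─ (here _)  (_ ∷ u)  = u
    Unique-─ (there i) (x≉ ∷ u) = Allₚ.─⁺ i x≉ ∷ Unique-─ i u

    ─-≉-lookup : ∀ {xs} (i : Any P xs) → Unique xs → All (λ z → ¬ z ≈ Any.lookup i) (xs ─ i)
    ─-≉-lookup (here _)  (x≉ ∷ _) = All.map (λ x≉z z≈x → x≉z (sym z≈x)) x≉
    ─-≉-lookup (there i) (x≉ ∷ u) = proj₁ (All.lookupAny x≉ i) ∷ ─-≉-lookup i u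

    ∈-─ : ∀ {xs z} (i : Any P xs) → z ∈ xs → ¬ z ≈ Any.lookup i → z ∈ (xs ─ i)
    ∈-─ (here _)  (here z≈)  z≉ = ⊥-elim (z≉ z≈)
    ∈-─ (here _)  (there z∈) _  = z∈
    ∈-─ (there _) (here z≈)  _  = here z≈
    ∈-─ (there i) (there z∈) z≉ = there (∈-─ i z∈ z≉)

  Unique⇒length≤ : ∀ {zs xs} → Unique zs → All (_∈ xs) zs → length zs ℕ.≤ length xs
  Unique⇒length≤ [] [] = z≤n
  Unique⇒length≤ {xs = xs} (z≉ ∷ u) (z∈ ∷ zs⊆xs) =
    ≡.subst (_ ℕ.≤_) (≡.sym (List.length-removeAt′ xs (Any.index z∈)))
      (s≤s (Unique⇒length≤ u (All.zipWith ∈xs─z∈ (zs⊆xs , z≉))))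
    where
    ∈xs─z∈ : ∀ {w} → (w ∈ xs) × ¬ _ ≈ w → w ∈ (xs ─ z∈)
    ∈xs─z∈ (w∈ , z≉w) = ∈-─ z∈ w∈ λ w≈ → z≉w (trans (Anyₚ.lookup-result z∈) (sym w≈))

  module _ (_≟_ : Decidable _≈_) {xs} (complete : ∀ x → x ∈ xs) (unique : Unique xs) where

    injective⇒surjective : (f : A → A) → (∀ {x y} → f x ≈ f y → x ≈ y) → ∀ y → ∃[ x ] (y ≈ f x)
    injective⇒surjective f f-inj y with Any.any? (y ≟_) (map f xs)
    ... | yes y∈fxs = let i = Anyₚ.map⁻ y∈fxs in Any.lookup i , Anyₚ.lookup-result i
    ... | no  y∉fxs = ⊥-elim (ℕₚ.<-irrefl ≡.refl (≡.subst (λ n → ℕ.suc n ℕ.≤ length xs) (List.length-map f xs)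
                        (Unique⇒length≤ y∷fxs-unique (All.universal complete _))))
      where
      y∷fxs-unique : Unique (y ∷ map f xs)
      y∷fxs-unique = Allₚ.¬Any⇒All¬ _ y∉fxs ∷ AllPairsₚ.map⁺ (AllPairs.map (λ x≉x′ → x≉x′ ∘′ f-inj) unique)

module UniqueSums {c ℓ} (M : CommutativeMonoid c ℓ) where
  open CommutativeMonoid M
  open import Algebra.Properties.CommutativeSemigroup commutativeSemigroup using (x∙yz≈y∙xz; interchange)
  open import Algebra.Properties.Monoid.Mult monoid using () renaming (_×_ to _×ₙ_)
  open import Data.List.Membership.Setoid setoid using (_∈_)
  open import Data.List.Relation.Unary.Unique.Setoid setoid using (Unique)
  open import Relation.Binary.Reasoning.Setoid setoid
  open UniqueLists setoid

  ∑ : List Carrier → Carrier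
  ∑ = foldr _∙_ ε

  ∑-─ : ∀ {p} {P : Pred Carrier p} {xs} (i : Any P xs) → ∑ xs ≈ Any.lookup i ∙ ∑ (xs ─ i)
  ∑-─ (here _) = refl
  ∑-─ {xs = x ∷ _} (there i) = trans (∙-congˡ (∑-─ i)) (x∙yz≈y∙xz x _ _)

  ∑-unique : ∀ {xs ys} → Unique xs → Unique ys → All (_∈ ys) xs → All (_∈ xs) ys → ∑ xs ≈ ∑ ys
  ∑-unique {[]} {[]} _ _ _ _ = refl
  ∑-unique {[]} {_ ∷ _} _ _ _ (() ∷ _)
  ∑-unique {x ∷ xs} {ys} (x≉ ∷ xs!) ys! (x∈ys ∷ xs⊆ys) ys⊆x∷xs = begin
    x ∙ ∑ xs                        ≈⟨ ∙-cong x≈y (∑-unique xs! (Unique-─ x∈ys ys!) xs⊆ys─ ys─⊆xs) ⟩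
    Any.lookup x∈ys ∙ ∑ (ys ─ x∈ys) ≈⟨ ∑-─ x∈ys ⟨
    ∑ ys                            ∎
    where
    x≈y : x ≈ Any.lookup x∈ys
    x≈y = Anyₚ.lookup-result x∈ys
    xs⊆ys─ : All (_∈ (ys ─ x∈ys)) xs
    xs⊆ys─ = All.zipWith (λ (z∈ , x≉z) → ∈-─ x∈ys z∈ λ z≈y → x≉z (trans x≈y (sym z≈y))) (xs⊆ys , x≉)
    drop-x : ∀ {z} → z ∈ (x ∷ xs) × ¬ z ≈ Any.lookup x∈ys → z ∈ xs
    drop-x (here z≈x , z≉y) = ⊥-elim (z≉y (trans z≈x x≈y))
    drop-x (there z∈ , _)   = z∈
    ys─⊆xs : All (_∈ xs) (ys ─ x∈ys)
    ys─⊆xs = All.zipWith drop-x (Allₚ.─⁺ x∈ys ys⊆x∷xs , ─-≉-lookup x∈ys ys!)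

  ∑-map-∙ˡ : ∀ a xs → ∑ (map (a ∙_) xs) ≈ (length xs ×ₙ a) ∙ ∑ xs
  ∑-map-∙ˡ a [] = sym (identityˡ ε)
  ∑-map-∙ˡ a (x ∷ xs) = trans (∙-congˡ (∑-map-∙ˡ a xs)) (interchange a x _ _)

Characteristic3 : ∀ {c ℓ} → FiniteField c ℓ → Set ℓ
Characteristic3 F = 1# + 1# + 1# ≈ 0#
  where open FiniteField F

module FiniteFieldProperties {c ℓ} (F : FiniteField c ℓ) where
  open FiniteField F
  open import Algebra.Properties.Ring ring using (+-identityˡ-unique; +-cancelˡ)
  open import Algebra.Properties.Semiring.Mult semiring using (×1-homo-*) renaming (_×_ to _×ₙ_)
  open import Relation.Binary.Reasoning.Setoid setoid
  open UniqueLists setoid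
  open UniqueSums +-commutativeMonoid

  infix 4 _≟_
  _≟_ : Decidable _≈_
  x ≟ y = ≈-decidable-on distinct (complete x) (complete y)

  inv : ∀ x → ¬ x ≈ 0# → Carrier
  inv x x≉0 = proj₁ (inverse x x≉0)

  inv-inverseʳ : ∀ x x≉0 → x * inv x x≉0 ≈ 1#
  inv-inverseʳ x x≉0 = proj₂ (inverse x x≉0)

  x*y≈0⇒y≈0 : ∀ {x y} → ¬ x ≈ 0# → x * y ≈ 0# → y ≈ 0#
  x*y≈0⇒y≈0 {x} {y} x≉0 xy≈0 = begin
    y              ≈⟨ *-identityˡ y ⟨
    1# * y         ≈⟨ *-congʳ (trans (sym (inv-inverseʳ x x≉0)) (*-comm x _)) ⟩
    (x⁻¹ * x) * y  ≈⟨ *-assoc x⁻¹ x y ⟩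
    x⁻¹ * (x * y)  ≈⟨ *-congˡ xy≈0 ⟩
    x⁻¹ * 0#       ≈⟨ zeroʳ x⁻¹ ⟩
    0#             ∎
    where x⁻¹ = inv x x≉0

  x*y≈0⇒x≈0⊎y≈0 : ∀ {x y} → x * y ≈ 0# → x ≈ 0# ⊎ y ≈ 0#
  x*y≈0⇒x≈0⊎y≈0 {x} xy≈0 with x ≟ 0#
  ... | yes x≈0 = inj₁ x≈0
  ... | no  x≉0 = inj₂ (x*y≈0⇒y≈0 x≉0 xy≈0)

  nonzeros : List Carrier
  nonzeros = elements ─ complete 0#

  nonzeros-≉0 : All (λ z → ¬ z ≈ 0#) nonzeros
  nonzeros-≉0 = All.map (λ z≉ z≈0 → z≉ (trans z≈0 (Anyₚ.lookup-result (complete 0#))))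
                        (─-≉-lookup (complete 0#) distinct)

  nonzeros-unique : AllPairs (λ x y → ¬ x ≈ y) nonzeros
  nonzeros-unique = Unique-─ (complete 0#) distinct

  ∈-nonzeros : ∀ z → ¬ z ≈ 0# → Any (z ≈_) nonzeros
  ∈-nonzeros z z≉0 = ∈-─ (complete 0#) (complete z) λ z≈ → z≉0 (trans z≈ (sym (Anyₚ.lookup-result (complete 0#))))

  length-nonzeros : length elements ≡ ℕ.suc (length nonzeros)
  length-nonzeros = List.length-removeAt′ elements (Any.index (complete 0#))

  order≥2 : 2 ℕ.≤ length elements
  order≥2 = ≡.subst (2 ℕ.≤_) (≡.sym length-nonzeros) (s≤s (nonempty (∈-nonzeros 1# 1≉0)))
    where
    nonempty : ∀ {xs} → Any (1# ≈_) xs → 1 ℕ.≤ length xs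
    nonempty (here _)  = s≤s z≤n
    nonempty (there _) = s≤s z≤n

  -- Translation by 1# permutes F, so ∑ F ≈ q·1 + ∑ F.
  order×1≈0 : length elements ×ₙ 1# ≈ 0#
  order×1≈0 = +-identityˡ-unique (length elements ×ₙ 1#) (∑ elements) (begin
    length elements ×ₙ 1# + ∑ elements  ≈⟨ ∑-map-∙ˡ 1# elements ⟨
    ∑ (map (1# +_) elements)            ≈⟨ ∑-unique translates-unique distinct
                                             (All.universal complete _) (All.universal ∈-translates _) ⟩
    ∑ elements                          ∎)
    where
    translates-unique : AllPairs (λ x y → ¬ x ≈ y) (map (1# +_) elements)
    translates-unique = AllPairsₚ.map⁺ (AllPairs.map (λ x≉y 1+x≈1+y → x≉y (+-cancelˡ 1# _ _ 1+x≈1+y)) distinct)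
    1+[x-1]≈x : ∀ x → 1# + (x - 1#) ≈ x
    1+[x-1]≈x x = begin
      1# + (x - 1#)    ≈⟨ +-comm 1# _ ⟩
      (x + - 1#) + 1#  ≈⟨ +-assoc x (- 1#) 1# ⟩
      x + (- 1# + 1#)  ≈⟨ +-congˡ (-‿inverseˡ 1#) ⟩
      x + 0#           ≈⟨ +-identityʳ x ⟩
      x                ∎
    ∈-translates : ∀ x → Any (x ≈_) (map (1# +_) elements)
    ∈-translates x = Anyₚ.map⁺ (Any.map (λ x-1≈z → trans (sym (1+[x-1]≈x x)) (+-congˡ x-1≈z)) (complete (x - 1#)))

  characteristic-three : ∃[ k ] (length elements ≡ 3 ℕ.^ k) → Characteristic3 F
  characteristic-three (k , q≡3^k) = begin
    1# + 1# + 1#    ≈⟨ +-assoc 1# 1# 1# ⟩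
    1# + (1# + 1#)  ≈⟨ +-congˡ (+-congˡ (+-identityʳ 1#)) ⟨
    3 ×ₙ 1#         ≈⟨ 3^k×1≈0⇒3×1≈0 k (≡.subst (λ n → n ×ₙ 1# ≈ 0#) q≡3^k order×1≈0) ⟩
    0#              ∎
    where
    3^k×1≈0⇒3×1≈0 : ∀ k → (3 ℕ.^ k) ×ₙ 1# ≈ 0# → 3 ×ₙ 1# ≈ 0#
    3^k×1≈0⇒3×1≈0 ℕ.zero    1≈0   = ⊥-elim (1≉0 (trans (sym (+-identityʳ 1#)) 1≈0))
    3^k×1≈0⇒3×1≈0 (ℕ.suc k) 3^[k+1]×1≈0 with x*y≈0⇒x≈0⊎y≈0 (trans (sym (×1-homo-* 3 (3 ℕ.^ k))) 3^[k+1]×1≈0)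
    ... | inj₁ 3×1≈0   = 3×1≈0
    ... | inj₂ 3^k×1≈0 = 3^k×1≈0⇒3×1≈0 k 3^k×1≈0

module Counting {a r p} {A : Set a} (_~_ : A → A → Set r) {P : A → Set p} where

  HasCount-singleton : ∀ {x} → P x → (∀ y → P y → y ~ x) → HasCount _~_ P 1
  HasCount-singleton {x} px ~x = x ∷ [] , (px ∷ [] , [] ∷ [] , λ y py → here (~x y py)) , ≡.refl

  HasCount-≤1 : (∀ {x y} → P x → P y → x ~ y) → ∀ {n} → HasCount _~_ P n → n ℕ.≤ 1
  HasCount-≤1 _ ([] , _ , ≡.refl)    = z≤n
  HasCount-≤1 _ (_ ∷ [] , _ , ≡.refl) = s≤s z≤n
  HasCount-≤1 all~ (_ ∷ _ ∷ _ , ((px ∷ py ∷ _) , ((x≁y ∷ _) ∷ _) , _) , _) = ⊥-elim (x≁y (all~ px py))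

  HasCount-≥1 : ∃[ x ] P x → ∀ {n} → HasCount _~_ P n → 1 ℕ.≤ n
  HasCount-≥1 (x , px) ([] , (_ , _ , complete) , _) with complete x px
  ... | ()
  HasCount-≥1 _ (_ ∷ _ , _ , ≡.refl) = s≤s z≤n

  AverageIs-constant : ∀ {s} {Cnt : A → ℕ → Set s} {xs} m → Enumerates _~_ P xs → ¬ length xs ≡ 0 →
                       All (λ x → Cnt x m) xs → AverageIs _~_ P Cnt m
  AverageIs-constant {Cnt = Cnt} {xs} m enum nonempty counts =
    xs , enum , nonempty , map (λ _ → m) xs , pointwise counts , sum-constant xs
    where
    pointwise : ∀ {ys} → All (λ x → Cnt x m) ys → Pointwise Cnt ys (map (λ _ → m) ys)
    pointwise []       = []
    pointwise (c ∷ cs) = c ∷ pointwise cs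
    sum-constant : ∀ ys → sum (map (λ _ → m) ys) ≡ m ℕ.* length ys
    sum-constant []       = ≡.sym (ℕₚ.*-zeroʳ m)
    sum-constant (_ ∷ ys) = ≡.trans (≡.cong (m ℕ.+_) (sum-constant ys)) (≡.sym (ℕₚ.*-suc m (length ys)))

data 𝔽₃ : Set where
  𝟎 𝟏 𝟐 : 𝔽₃

_+₃_ : 𝔽₃ → 𝔽₃ → 𝔽₃
𝟎 +₃ y = y
𝟏 +₃ 𝟎 = 𝟏
𝟏 +₃ 𝟏 = 𝟐
𝟏 +₃ 𝟐 = 𝟎
𝟐 +₃ 𝟎 = 𝟐
𝟐 +₃ 𝟏 = 𝟎
𝟐 +₃ 𝟐 = 𝟏

_*₃_ : 𝔽₃ → 𝔽₃ → 𝔽₃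
𝟎 *₃ y = 𝟎
𝟏 *₃ y = y
𝟐 *₃ 𝟎 = 𝟎
𝟐 *₃ 𝟏 = 𝟐
𝟐 *₃ 𝟐 = 𝟏

-₃_ : 𝔽₃ → 𝔽₃
-₃ 𝟎 = 𝟎
-₃ 𝟏 = 𝟐
-₃ 𝟐 = 𝟏

𝔽₃-rawRing : RawRing 0ℓ 0ℓ
𝔽₃-rawRing = record
  { Carrier = 𝔽₃ ; _≈_ = _≡_ ; _+_ = _+₃_ ; _*_ = _*₃_ ; -_ = -₃_ ; 0# = 𝟎 ; 1# = 𝟏 }

-- The ring solver with 𝔽₃ coefficients: it normalises modulo 3, so it proves
-- identities such as -(3·t) ≈ 0 that only hold in characteristic 3.
module Char3Solver {c ℓ} (F : FiniteField c ℓ) (char3 : Characteristic3 F) where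
  open FiniteField F
  open import Relation.Binary.Reasoning.Setoid setoid
  open import Algebra.Properties.Ring ring using (+-inverseʳ-unique)

  ⟦_⟧₃ : 𝔽₃ → Carrier
  ⟦ 𝟎 ⟧₃ = 0#
  ⟦ 𝟏 ⟧₃ = 1#
  ⟦ 𝟐 ⟧₃ = 1# + 1#

  2+2≈1 : (1# + 1#) + (1# + 1#) ≈ 1#
  2+2≈1 = begin
    (1# + 1#) + (1# + 1#)  ≈⟨ +-assoc (1# + 1#) 1# 1# ⟨
    (1# + 1# + 1#) + 1#    ≈⟨ +-congʳ char3 ⟩
    0# + 1#                ≈⟨ +-identityˡ 1# ⟩
    1#                     ∎

  +-homo : ∀ a b → ⟦ a +₃ b ⟧₃ ≈ ⟦ a ⟧₃ + ⟦ b ⟧₃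
  +-homo 𝟎 b = sym (+-identityˡ _)
  +-homo 𝟏 𝟎 = sym (+-identityʳ _)
  +-homo 𝟏 𝟏 = refl
  +-homo 𝟏 𝟐 = trans (sym char3) (+-assoc 1# 1# 1#)
  +-homo 𝟐 𝟎 = sym (+-identityʳ _)
  +-homo 𝟐 𝟏 = sym char3
  +-homo 𝟐 𝟐 = sym 2+2≈1

  *-homo : ∀ a b → ⟦ a *₃ b ⟧₃ ≈ ⟦ a ⟧₃ * ⟦ b ⟧₃
  *-homo 𝟎 b = sym (zeroˡ _)
  *-homo 𝟏 b = sym (*-identityˡ _)
  *-homo 𝟐 𝟎 = sym (zeroʳ _)
  *-homo 𝟐 𝟏 = sym (*-identityʳ _)
  *-homo 𝟐 𝟐 = begin
    1#                               ≈⟨ 2+2≈1 ⟨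
    (1# + 1#) + (1# + 1#)            ≈⟨ +-cong (*-identityˡ _) (*-identityˡ _) ⟨
    1# * (1# + 1#) + 1# * (1# + 1#)  ≈⟨ distribʳ (1# + 1#) 1# 1# ⟨
    (1# + 1#) * (1# + 1#)            ∎

  -‿homo : ∀ a → ⟦ -₃ a ⟧₃ ≈ - ⟦ a ⟧₃
  -‿homo 𝟎 = +-inverseʳ-unique 0# 0# (+-identityˡ 0#)
  -‿homo 𝟏 = +-inverseʳ-unique 1# (1# + 1#) (trans (sym (+-assoc 1# 1# 1#)) char3)
  -‿homo 𝟐 = +-inverseʳ-unique (1# + 1#) 1# char3

  𝔽₃⟶F : 𝔽₃-rawRing -Raw-AlmostCommutative⟶ fromCommutativeRing commRing
  𝔽₃⟶F = record
    { ⟦_⟧ = ⟦_⟧₃ ; +-homo = +-homo ; *-homo = *-homo ; -‿homo = -‿homo ; 0-homo = refl ; 1-homo = refl }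

  _≟₃_ : ∀ a b → Maybe (⟦ a ⟧₃ ≈ ⟦ b ⟧₃)
  𝟎 ≟₃ 𝟎 = just refl
  𝟏 ≟₃ 𝟏 = just refl
  𝟐 ≟₃ 𝟐 = just refl
  _ ≟₃ _ = nothing

  open RingSolver 𝔽₃-rawRing (fromCommutativeRing commRing) 𝔽₃⟶F _≟₃_ public
    using (solve; _:=_; con; _:+_; _:*_; _:-_; :-_; Polynomial)

  :0 :1 : ∀ {n} → Polynomial n
  :0 = con 𝟎
  :1 = con 𝟏

module Char3Geometry {c ℓ} (F : FiniteField c ℓ) (char3 : Characteristic3 F) where
  open FiniteField F
  open FiniteFieldProperties F
  open Char3Solver F char3
  open Geometry F
  open UniqueLists setoid using (injective⇒surjective)
  open import Algebra.Properties.Ring ring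
    using (x∙y⁻¹≈ε⇒x≈y; x≈y⇒x∙y⁻¹≈ε; -‿injective; -0#≈0#)
  open import Relation.Binary.Reasoning.Setoid setoid

  zero-combination₁ : ∀ {t h} k → t ≈ k * h → h ≈ 0# → t ≈ 0#
  zero-combination₁ k t≈ h≈0 = trans t≈ (trans (*-congˡ h≈0) (zeroʳ k))

  zero-combination₂ : ∀ {t h₁ h₂} k₁ k₂ → t ≈ k₁ * h₁ + k₂ * h₂ → h₁ ≈ 0# → h₂ ≈ 0# → t ≈ 0#
  zero-combination₂ k₁ k₂ t≈ h₁≈0 h₂≈0 =
    trans t≈ (trans (+-cong (zero-combination₁ k₁ refl h₁≈0) (zero-combination₁ k₂ refl h₂≈0)) (+-identityˡ 0#))

  -x≈0⇒x≈0 : ∀ {x} → - x ≈ 0# → x ≈ 0#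
  -x≈0⇒x≈0 -x≈0 = -‿injective (trans -x≈0 (sym -0#≈0#))

  x³≈0⇒x≈0 : ∀ {x} → x * x * x ≈ 0# → x ≈ 0#
  x³≈0⇒x≈0 x³≈0 with x*y≈0⇒x≈0⊎y≈0 x³≈0
  ... | inj₂ x≈0 = x≈0
  ... | inj₁ x²≈0 with x*y≈0⇒x≈0⊎y≈0 x²≈0
  ...   | inj₁ x≈0 = x≈0
  ...   | inj₂ x≈0 = x≈0

  -- In characteristic 3, (x - y)³ ≈ x³ - y³.
  cube-injective : ∀ {x y} → x * x * x ≈ y * y * y → x ≈ y
  cube-injective {x} {y} x³≈y³ = x∙y⁻¹≈ε⇒x≈y x y (x³≈0⇒x≈0 (trans
    (solve 2 (λ x y → (x :- y) :* (x :- y) :* (x :- y) := x :* x :* x :- y :* y :* y) refl x y)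
    (x≈y⇒x∙y⁻¹≈ε x³≈y³)))

  cube-root : ∀ y → ∃[ r ] (r * r * r ≈ y)
  cube-root y with injective⇒surjective _≟_ complete distinct (λ x → x * x * x) cube-injective y
  ... | r , y≈r³ = r , sym y≈r³

  -- Vectors, planes and lines of PG(3, q)

  ≈v-refl : ∀ {u} → u ≈v u
  ≈v-refl = refl , refl , refl , refl

  ≈v-sym : ∀ {u w} → u ≈v w → w ≈v u
  ≈v-sym (e₀ , e₁ , e₂ , e₃) = sym e₀ , sym e₁ , sym e₂ , sym e₃

  ≈v-trans : ∀ {u w z} → u ≈v w → w ≈v z → u ≈v z
  ≈v-trans (e₀ , e₁ , e₂ , e₃) (f₀ , f₁ , f₂ , f₃) = trans e₀ f₀ , trans e₁ f₁ , trans e₂ f₂ , trans e₃ f₃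

  ·-cong : ∀ {a b u w} → a ≈ b → u ≈v w → (a · u) ≈v (b · w)
  ·-cong a≈b (e₀ , e₁ , e₂ , e₃) = *-cong a≈b e₀ , *-cong a≈b e₁ , *-cong a≈b e₂ , *-cong a≈b e₃

  ⊕-cong : ∀ {u u′ w w′} → u ≈v u′ → w ≈v w′ → (u ⊕ w) ≈v (u′ ⊕ w′)
  ⊕-cong (e₀ , e₁ , e₂ , e₃) (f₀ , f₁ , f₂ , f₃) = +-cong e₀ f₀ , +-cong e₁ f₁ , +-cong e₂ f₂ , +-cong e₃ f₃

  ·-identityˡ : ∀ u → u ≈v (1# · u)
  ·-identityˡ u = sym (*-identityˡ _) , sym (*-identityˡ _) , sym (*-identityˡ _) , sym (*-identityˡ _)

  ·-assoc : ∀ a b u → (a · (b · u)) ≈v ((a * b) · u)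
  ·-assoc a b u = sym (*-assoc a b _) , sym (*-assoc a b _) , sym (*-assoc a b _) , sym (*-assoc a b _)

  ·-zero : ∀ {a u w} → u ≈v (a · w) → a ≈ 0# → u ≈v zeroV
  ·-zero (e₀ , e₁ , e₂ , e₃) a≈0 = z e₀ , z e₁ , z e₂ , z e₃
    where
    z : ∀ {x y} → x ≈ _ * y → x ≈ 0#
    z x≈ay = trans x≈ay (trans (*-congʳ a≈0) (zeroˡ _))

  ·-invert : ∀ {u w a} → u ≈v (a · w) → (a≉0 : ¬ a ≈ 0#) → w ≈v (inv a a≉0 · u)
  ·-invert {a = a} (e₀ , e₁ , e₂ , e₃) a≉0 = f e₀ , f e₁ , f e₂ , f e₃
    where
    a⁻¹ = inv a a≉0
    f : ∀ {x y} → y ≈ a * x → x ≈ a⁻¹ * y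
    f {x} {y} y≈ax = sym (begin
      a⁻¹ * y        ≈⟨ *-congˡ y≈ax ⟩
      a⁻¹ * (a * x)  ≈⟨ *-assoc a⁻¹ a x ⟨
      a⁻¹ * a * x    ≈⟨ *-congʳ (trans (*-comm a⁻¹ a) (inv-inverseʳ a a≉0)) ⟩
      1# * x         ≈⟨ *-identityˡ x ⟩
      x              ∎)

  _⊙_ : V4 → V4 → Carrier
  cf ⊙ u = x0 cf * x0 u + x1 cf * x1 u + x2 cf * x2 u + x3 cf * x3 u

  ⊙-cong : ∀ {cf cf′ u u′} → cf ≈v cf′ → u ≈v u′ → cf ⊙ u ≈ cf′ ⊙ u′
  ⊙-cong (e₀ , e₁ , e₂ , e₃) (f₀ , f₁ , f₂ , f₃) =
    +-cong (+-cong (+-cong (*-cong e₀ f₀) (*-cong e₁ f₁)) (*-cong e₂ f₂)) (*-cong e₃ f₃)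

  ⊙-·ˡ : ∀ a cf u → (a · cf) ⊙ u ≈ a * (cf ⊙ u)
  ⊙-·ˡ a (v4 c0 c1 c2 c3) (v4 u0 u1 u2 u3) =
    solve 9 (λ a c0 c1 c2 c3 u0 u1 u2 u3 →
      (a :* c0) :* u0 :+ (a :* c1) :* u1 :+ (a :* c2) :* u2 :+ (a :* c3) :* u3
      := a :* (c0 :* u0 :+ c1 :* u1 :+ c2 :* u2 :+ c3 :* u3)) refl a c0 c1 c2 c3 u0 u1 u2 u3

  ⊙-·ʳ : ∀ a cf u → cf ⊙ (a · u) ≈ a * (cf ⊙ u)
  ⊙-·ʳ a (v4 c0 c1 c2 c3) (v4 u0 u1 u2 u3) =
    solve 9 (λ a c0 c1 c2 c3 u0 u1 u2 u3 →
      c0 :* (a :* u0) :+ c1 :* (a :* u1) :+ c2 :* (a :* u2) :+ c3 :* (a :* u3)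
      := a :* (c0 :* u0 :+ c1 :* u1 :+ c2 :* u2 :+ c3 :* u3)) refl a c0 c1 c2 c3 u0 u1 u2 u3

  ⊙-linearʳ : ∀ cf α u β w → cf ⊙ ((α · u) ⊕ (β · w)) ≈ α * (cf ⊙ u) + β * (cf ⊙ w)
  ⊙-linearʳ (v4 c0 c1 c2 c3) α (v4 u0 u1 u2 u3) β (v4 w0 w1 w2 w3) =
    solve 14 (λ c0 c1 c2 c3 α u0 u1 u2 u3 β w0 w1 w2 w3 →
      c0 :* (α :* u0 :+ β :* w0) :+ c1 :* (α :* u1 :+ β :* w1) :+ c2 :* (α :* u2 :+ β :* w2) :+ c3 :* (α :* u3 :+ β :* w3)
      := α :* (c0 :* u0 :+ c1 :* u1 :+ c2 :* u2 :+ c3 :* u3) :+ β :* (c0 :* w0 :+ c1 :* w1 :+ c2 :* w2 :+ c3 :* w3))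
      refl c0 c1 c2 c3 α u0 u1 u2 u3 β w0 w1 w2 w3

  ∈π-respˡ : ∀ {u u′ cf} → u ≈v u′ → u ∈π cf → u′ ∈π cf
  ∈π-respˡ u≈u′ u∈ = trans (sym (⊙-cong ≈v-refl u≈u′)) u∈

  ∈π-respʳ : ∀ {u cf cf′} → cf ≈v cf′ → u ∈π cf → u ∈π cf′
  ∈π-respʳ cf≈cf′ u∈ = trans (sym (⊙-cong cf≈cf′ ≈v-refl)) u∈

  ∈π-·ʳ : ∀ {u cf} a → u ∈π cf → u ∈π (a · cf)
  ∈π-·ʳ {u} {cf} a u∈ = zero-combination₁ a (⊙-·ˡ a cf u) u∈

  ∈π-·ˡ⁻ : ∀ {u cf a} → ¬ a ≈ 0# → (a · u) ∈π cf → u ∈π cf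
  ∈π-·ˡ⁻ {u} {cf} {a} a≉0 au∈ = x*y≈0⇒y≈0 a≉0 (trans (sym (⊙-·ʳ a cf u)) au∈)

  ∈π-∼ : ∀ {u cf cf′} → cf ∼ cf′ → u ∈π cf → u ∈π cf′
  ∈π-∼ (a , cf′≈) u∈ = ∈π-respʳ (≈v-sym cf′≈) (∈π-·ʳ a u∈)

  ∈ℓ⇒∈π : ∀ {x u w cf} → u ∈π cf → w ∈π cf → x ∈ℓ (u , w) → x ∈π cf
  ∈ℓ⇒∈π {u = u} {w} {cf} u∈ w∈ (α , β , x≈) =
    trans (⊙-cong ≈v-refl x≈) (zero-combination₂ α β (⊙-linearʳ cf α u β w) u∈ w∈)

  ∈ℓ-first : ∀ u w → u ∈ℓ (u , w)
  ∈ℓ-first u w = 1# , 0# , (e (x0 u) (x0 w) , e (x1 u) (x1 w) , e (x2 u) (x2 w) , e (x3 u) (x3 w))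
    where
    e : ∀ a b → a ≈ 1# * a + 0# * b
    e = solve 2 (λ a b → a := :1 :* a :+ :0 :* b) refl

  ∈ℓ-second : ∀ u w → w ∈ℓ (u , w)
  ∈ℓ-second u w = 0# , 1# , (e (x0 u) (x0 w) , e (x1 u) (x1 w) , e (x2 u) (x2 w) , e (x3 u) (x3 w))
    where
    e : ∀ a b → b ≈ 0# * a + 1# * b
    e = solve 2 (λ a b → b := :0 :* a :+ :1 :* b) refl

  axis-combination : ∀ a b → (0# ≈ a * 0# + b * 0#) × (a ≈ a * 1# + b * 0#) × (b ≈ a * 0# + b * 1#)
  axis-combination a b = solve 2 (λ a b → :0 := a :* :0 :+ b :* :0) refl a b ,
                         solve 2 (λ a b → a := a :* :1 :+ b :* :0) refl a b ,
                         solve 2 (λ a b → b := a :* :0 :+ b :* :1) refl a b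

  ∈ℓ-respˡ : ∀ {x x′ L} → x ≈v x′ → x ∈ℓ L → x′ ∈ℓ L
  ∈ℓ-respˡ x≈x′ (α , β , x≈) = α , β , ≈v-trans (≈v-sym x≈x′) x≈

  ∈ℓ-respʳ : ∀ {x u u′ w w′} → u ≈v u′ → w ≈v w′ → x ∈ℓ (u , w) → x ∈ℓ (u′ , w′)
  ∈ℓ-respʳ u≈u′ w≈w′ (α , β , x≈) = α , β , ≈v-trans x≈ (⊕-cong (·-cong refl u≈u′) (·-cong refl w≈w′))

  ≗ℓ-respʳ : ∀ {u w a b a′ b′} → a ≈v a′ → b ≈v b′ → (u , w) ≗ℓ (a , b) → (u , w) ≗ℓ (a′ , b′)
  ≗ℓ-respʳ a≈ b≈ (a∈ , b∈ , u∈ , w∈) =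
    ∈ℓ-respˡ a≈ a∈ , ∈ℓ-respˡ b≈ b∈ , ∈ℓ-respʳ a≈ b≈ u∈ , ∈ℓ-respʳ a≈ b≈ w∈

  ∈ℓ-trans : ∀ {x a b u w} → x ∈ℓ (a , b) → a ∈ℓ (u , w) → b ∈ℓ (u , w) → x ∈ℓ (u , w)
  ∈ℓ-trans (α , β , (e₀ , e₁ , e₂ , e₃)) (α₁ , β₁ , (a₀ , a₁ , a₂ , a₃)) (α₂ , β₂ , (b₀ , b₁ , b₂ , b₃)) =
    α * α₁ + β * α₂ , α * β₁ + β * β₂ ,
    (substitute e₀ a₀ b₀ , substitute e₁ a₁ b₁ , substitute e₂ a₂ b₂ , substitute e₃ a₃ b₃)
    where
    substitute : ∀ {x a b u w} → x ≈ α * a + β * b → a ≈ α₁ * u + β₁ * w → b ≈ α₂ * u + β₂ * w →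
                 x ≈ (α * α₁ + β * α₂) * u + (α * β₁ + β * β₂) * w
    substitute {u = u} {w} x≈ a≈ b≈ = trans x≈ (trans (+-cong (*-congˡ a≈) (*-congˡ b≈))
      (solve 8 (λ α β α₁ β₁ α₂ β₂ u w → α :* (α₁ :* u :+ β₁ :* w) :+ β :* (α₂ :* u :+ β₂ :* w)
                  := (α :* α₁ :+ β :* α₂) :* u :+ (α :* β₁ :+ β :* β₂) :* w) refl α β α₁ β₁ α₂ β₂ u w))

  module Cramer (α₁ β₁ α₂ β₂ : Carrier) where

    det : Carrier
    det = α₁ * β₂ - α₂ * β₁

    module _ {u w p r} (u≈ : u ≈ α₁ * p + β₁ * r) (w≈ : w ≈ α₂ * p + β₂ * r) where

      cramer₁ : ∀ k → k * det ≈ 1# → p ≈ (k * β₂) * u + (- (k * β₁)) * w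
      cramer₁ k k*det≈1 = sym (begin
        (k * β₂) * u + (- (k * β₁)) * w  ≈⟨ +-cong (*-congˡ u≈) (*-congˡ w≈) ⟩
        (k * β₂) * (α₁ * p + β₁ * r) + (- (k * β₁)) * (α₂ * p + β₂ * r)
          ≈⟨ solve 7 (λ α₁ β₁ α₂ β₂ k p r →
               (k :* β₂) :* (α₁ :* p :+ β₁ :* r) :+ (:- (k :* β₁)) :* (α₂ :* p :+ β₂ :* r)
               := (k :* (α₁ :* β₂ :- α₂ :* β₁)) :* p) refl α₁ β₁ α₂ β₂ k p r ⟩
        (k * det) * p                    ≈⟨ trans (*-congʳ k*det≈1) (*-identityˡ p) ⟩
        p                                ∎)

      cramer₂ : ∀ k → k * det ≈ 1# → r ≈ (- (k * α₂)) * u + (k * α₁) * w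
      cramer₂ k k*det≈1 = sym (begin
        (- (k * α₂)) * u + (k * α₁) * w  ≈⟨ +-cong (*-congˡ u≈) (*-congˡ w≈) ⟩
        (- (k * α₂)) * (α₁ * p + β₁ * r) + (k * α₁) * (α₂ * p + β₂ * r)
          ≈⟨ solve 7 (λ α₁ β₁ α₂ β₂ k p r →
               (:- (k :* α₂)) :* (α₁ :* p :+ β₁ :* r) :+ (k :* α₁) :* (α₂ :* p :+ β₂ :* r)
               := (k :* (α₁ :* β₂ :- α₂ :* β₁)) :* r) refl α₁ β₁ α₂ β₂ k p r ⟩
        (k * det) * r                    ≈⟨ trans (*-congʳ k*det≈1) (*-identityˡ r) ⟩
        r                                ∎)

      singular₁ : det ≈ 0# → β₂ * u + (- β₁) * w ≈ 0#
      singular₁ = zero-combination₁ p (trans (+-cong (*-congˡ u≈) (*-congˡ w≈))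
        (solve 6 (λ α₁ β₁ α₂ β₂ p r → β₂ :* (α₁ :* p :+ β₁ :* r) :+ (:- β₁) :* (α₂ :* p :+ β₂ :* r)
                   := p :* (α₁ :* β₂ :- α₂ :* β₁)) refl α₁ β₁ α₂ β₂ p r))

      singular₂ : det ≈ 0# → α₂ * u + (- α₁) * w ≈ 0#
      singular₂ = zero-combination₁ (- r) (trans (+-cong (*-congˡ u≈) (*-congˡ w≈))
        (solve 6 (λ α₁ β₁ α₂ β₂ p r → α₂ :* (α₁ :* p :+ β₁ :* r) :+ (:- α₁) :* (α₂ :* p :+ β₂ :* r)
                   := (:- r) :* (α₁ :* β₂ :- α₂ :* β₁)) refl α₁ β₁ α₂ β₂ p r))

      vanishing : α₁ ≈ 0# → β₁ ≈ 0# → 1# * u + 0# * w ≈ 0#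
      vanishing α₁≈0 β₁≈0 = trans (+-cong (*-congˡ u≈0) (zeroˡ w)) (trans (+-identityʳ _) (zeroʳ 1#))
        where
        u≈0 : u ≈ 0#
        u≈0 = trans u≈ (trans (+-cong (trans (*-congʳ α₁≈0) (zeroˡ p)) (trans (*-congʳ β₁≈0) (zeroˡ r)))
                              (+-identityˡ 0#))

  -- The coefficients come from Cramer's rule.
  span-exchange : ∀ {u w p r} → Independent u w → u ∈ℓ (p , r) → w ∈ℓ (p , r) → p ∈ℓ (u , w) × r ∈ℓ (u , w)
  span-exchange ind (α₁ , β₁ , (u₀ , u₁ , u₂ , u₃)) (α₂ , β₂ , (w₀ , w₁ , w₂ , w₃)) with Cramer.det α₁ β₁ α₂ β₂ ≟ 0#
  ... | yes det≈0 = ⊥-elim (1≉0 (proj₁ (ind 1# 0#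
        (vanishing u₀ w₀ α₁≈0 β₁≈0 , vanishing u₁ w₁ α₁≈0 β₁≈0 ,
         vanishing u₂ w₂ α₁≈0 β₁≈0 , vanishing u₃ w₃ α₁≈0 β₁≈0))))
    where
    open Cramer α₁ β₁ α₂ β₂
    s₁ = ind β₂ (- β₁) (singular₁ u₀ w₀ det≈0 , singular₁ u₁ w₁ det≈0 , singular₁ u₂ w₂ det≈0 , singular₁ u₃ w₃ det≈0)
    s₂ = ind α₂ (- α₁) (singular₂ u₀ w₀ det≈0 , singular₂ u₁ w₁ det≈0 , singular₂ u₂ w₂ det≈0 , singular₂ u₃ w₃ det≈0)
    α₁≈0 = -x≈0⇒x≈0 (proj₂ s₂)
    β₁≈0 = -x≈0⇒x≈0 (proj₂ s₁)
  ... | no det≉0 =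
        (k * β₂ , - (k * β₁) , (cramer₁ u₀ w₀ k k*det≈1 , cramer₁ u₁ w₁ k k*det≈1 ,
                                cramer₁ u₂ w₂ k k*det≈1 , cramer₁ u₃ w₃ k k*det≈1)) ,
        (- (k * α₂) , k * α₁ , (cramer₂ u₀ w₀ k k*det≈1 , cramer₂ u₁ w₁ k k*det≈1 ,
                                cramer₂ u₂ w₂ k k*det≈1 , cramer₂ u₃ w₃ k k*det≈1))
    where
    open Cramer α₁ β₁ α₂ β₂
    k = inv det det≉0
    k*det≈1 = trans (*-comm k det) (inv-inverseʳ det det≉0)

  -- Osculating planes and the axis

  _≈ₚ_ : Param → Param → Set (c ⊔ ℓ)
  _≈ₚ_ = Maybe.Pointwise _≈_

  ≈ₚ-sym : ∀ {t t′} → t ≈ₚ t′ → t′ ≈ₚ t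
  ≈ₚ-sym = Maybe.sym sym

  P-cong : ∀ {t t′} → t ≈ₚ t′ → P t ≈v P t′
  P-cong (just τ≈) = *-cong (*-cong τ≈ τ≈) τ≈ , *-cong τ≈ τ≈ , τ≈ , refl
  P-cong nothing   = ≈v-refl

  Osc-cong : ∀ {t t′} → t ≈ₚ t′ → Osc t ≈v Osc t′
  Osc-cong (just τ≈) = refl , -‿cong (*-congˡ τ≈) , *-congˡ (*-cong τ≈ τ≈) , -‿cong (*-cong (*-cong τ≈ τ≈) τ≈)
  Osc-cong nothing   = ≈v-refl

  P-isPoint : ∀ t → IsPoint (P t)
  P-isPoint (just τ) (_ , _ , _ , 1≈0) = 1≉0 1≈0
  P-isPoint nothing  (1≈0 , _)         = 1≉0 1≈0

  P-onC : ∀ t → OnC (P t)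
  P-onC t = t , 1# , ·-identityˡ (P t)

  Osc-isPlane : ∀ t → IsPlane (Osc t)
  Osc-isPlane (just τ) (1≈0 , _)         = 1≉0 1≈0
  Osc-isPlane nothing  (_ , _ , _ , 1≈0) = 1≉0 1≈0

  Osc-isΓ : ∀ t → IsΓ (Osc t)
  Osc-isΓ t = Osc-isPlane t , t , 1# , ·-identityˡ (Osc t)

  -- In characteristic 3 the coefficients -3t and 3t² of the osculating plane vanish.
  Osc-x1≈0 : ∀ t → x1 (Osc t) ≈ 0#
  Osc-x1≈0 (just τ) = solve 1 (λ τ → :- ((:1 :+ :1 :+ :1) :* τ) := :0) refl τ
  Osc-x1≈0 nothing  = refl

  Osc-x2≈0 : ∀ t → x2 (Osc t) ≈ 0#
  Osc-x2≈0 (just τ) = solve 1 (λ τ → (:1 :+ :1 :+ :1) :* (τ :* τ) := :0) refl τ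
  Osc-x2≈0 nothing  = refl

  Osc-injective : ∀ t t′ → Osc t ∼ Osc t′ → t ≈ₚ t′
  Osc-injective (just τ) (just τ′) (a , (e₀ , _ , _ , e₃)) = just (sym (cube-injective (begin
    τ′ * τ′ * τ′            ≈⟨ solve 1 (λ x → x := :- (:- x)) refl _ ⟩
    - (- (τ′ * τ′ * τ′))    ≈⟨ -‿cong e₃ ⟩
    - (a * - (τ * τ * τ))   ≈⟨ -‿cong (*-congʳ a≈1) ⟩
    - (1# * - (τ * τ * τ))  ≈⟨ solve 1 (λ y → :- (:1 :* (:- y)) := y) refl _ ⟩
    τ * τ * τ               ∎)))
    where
    a≈1 : a ≈ 1#
    a≈1 = sym (trans e₀ (*-identityʳ a))
  Osc-injective (just τ) nothing (a , (e₀ , _ , _ , e₃)) = ⊥-elim (1≉0 (trans e₃ (trans (*-congʳ a≈0) (zeroˡ _))))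
    where
    a≈0 : a ≈ 0#
    a≈0 = trans (sym (*-identityʳ a)) (sym e₀)
  Osc-injective nothing (just τ′) (a , (e₀ , _)) = ⊥-elim (1≉0 (trans e₀ (zeroʳ a)))
  Osc-injective nothing nothing _ = nothing

  Osc⊙P : ∀ τ τ′ → Osc (just τ) ⊙ P (just τ′) ≈ (τ′ - τ) * (τ′ - τ) * (τ′ - τ)
  Osc⊙P τ τ′ = solve 2 (λ τ τ′ → :1 :* (τ′ :* τ′ :* τ′) :+ (:- ((:1 :+ :1 :+ :1) :* τ)) :* (τ′ :* τ′)
      :+ ((:1 :+ :1 :+ :1) :* (τ :* τ)) :* τ′ :+ (:- (τ :* τ :* τ)) :* :1
      := (τ′ :- τ) :* (τ′ :- τ) :* (τ′ :- τ)) refl τ τ′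

  P∈Osc⇒≈ₚ : ∀ t t′ → P t′ ∈π Osc t → t′ ≈ₚ t
  P∈Osc⇒≈ₚ (just τ) (just τ′) P∈ = just (x∙y⁻¹≈ε⇒x≈y τ′ τ (x³≈0⇒x≈0 (trans (sym (Osc⊙P τ τ′)) P∈)))
  P∈Osc⇒≈ₚ (just τ) nothing P∈ = ⊥-elim (1≉0 (trans (solve 1 (λ τ → :1 := :1 :* :1
      :+ (:- ((:1 :+ :1 :+ :1) :* τ)) :* :0 :+ ((:1 :+ :1 :+ :1) :* (τ :* τ)) :* :0 :+ (:- (τ :* τ :* τ)) :* :0) refl τ) P∈))
  P∈Osc⇒≈ₚ nothing (just τ′) P∈ = ⊥-elim (1≉0 (trans (solve 1 (λ τ → :1 := :0 :* (τ :* τ :* τ) :+ :0 :* (τ :* τ)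
      :+ :0 :* τ :+ :1 :* :1) refl τ′) P∈))
  P∈Osc⇒≈ₚ nothing nothing _ = nothing

  ThroughAxis : V4 → Set ℓ
  ThroughAxis cf = (x1 cf ≈ 0#) × (x2 cf ≈ 0#)

  ThroughAxis⇒axis⊆π : ∀ cf → ThroughAxis cf → axis ⊆π cf
  ThroughAxis⇒axis⊆π (v4 c0 c1 c2 c3) (c1≈0 , c2≈0) =
    trans (solve 4 (λ c0 c1 c2 c3 → c0 :* :0 :+ c1 :* :1 :+ c2 :* :0 :+ c3 :* :0 := c1) refl c0 c1 c2 c3) c1≈0 ,
    trans (solve 4 (λ c0 c1 c2 c3 → c0 :* :0 :+ c1 :* :0 :+ c2 :* :1 :+ c3 :* :0 := c2) refl c0 c1 c2 c3) c2≈0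

  axis⊆π⇒ThroughAxis : ∀ cf → axis ⊆π cf → ThroughAxis cf
  axis⊆π⇒ThroughAxis (v4 c0 c1 c2 c3) (e₁ , e₂) =
    trans (solve 4 (λ c0 c1 c2 c3 → c1 := c0 :* :0 :+ c1 :* :1 :+ c2 :* :0 :+ c3 :* :0) refl c0 c1 c2 c3) e₁ ,
    trans (solve 4 (λ c0 c1 c2 c3 → c2 := c0 :* :0 :+ c1 :* :0 :+ c2 :* :1 :+ c3 :* :0) refl c0 c1 c2 c3) e₂

  Γ⇒ThroughAxis : ∀ cf → IsΓ cf → ThroughAxis cf
  Γ⇒ThroughAxis cf (_ , t , a , (_ , e₁ , e₂ , _)) =
    zero-combination₁ a e₁ (Osc-x1≈0 t) , zero-combination₁ a e₂ (Osc-x2≈0 t)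

  -- A plane c₀x₀ + c₃x₃ = 0 through the axis is the osculating plane at a cube root of
  -- -c₃/c₀, or at ∞ if c₀ = 0.
  ThroughAxis⇒Γ : ∀ cf → IsPlane cf → ThroughAxis cf → IsΓ cf
  ThroughAxis⇒Γ cf@(v4 c0 c1 c2 c3) isPlane (c1≈0 , c2≈0) with c0 ≟ 0#
  ... | no c0≉0 = isPlane , just r , c0 , sym (*-identityʳ c0) ,
        trans c1≈0 (sym (zero-combination₁ c0 refl (Osc-x1≈0 (just r)))) ,
        trans c2≈0 (sym (zero-combination₁ c0 refl (Osc-x2≈0 (just r)))) ,
        sym (begin
          c0 * - (r * r * r)        ≈⟨ *-congˡ (-‿cong r³≈) ⟩
          c0 * - (- (c3 * c0⁻¹))    ≈⟨ solve 3 (λ c0 c3 i → c0 :* (:- (:- (c3 :* i))) := c3 :* (c0 :* i)) refl c0 c3 c0⁻¹ ⟩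
          c3 * (c0 * c0⁻¹)          ≈⟨ *-congˡ (inv-inverseʳ c0 c0≉0) ⟩
          c3 * 1#                   ≈⟨ *-identityʳ c3 ⟩
          c3                        ∎)
    where
    c0⁻¹ = inv c0 c0≉0
    r = proj₁ (cube-root (- (c3 * c0⁻¹)))
    r³≈ = proj₂ (cube-root (- (c3 * c0⁻¹)))
  ... | yes c0≈0 = isPlane , nothing , c3 , trans c0≈0 (sym (zeroʳ c3)) ,
        trans c1≈0 (sym (zeroʳ c3)) , trans c2≈0 (sym (zeroʳ c3)) , sym (*-identityʳ c3)

  ThroughAxis⇒⊙P : ∀ cf τ → ThroughAxis cf → cf ⊙ P (just τ) ≈ x0 cf * (τ * τ * τ) + x3 cf
  ThroughAxis⇒⊙P (v4 c0 c1 c2 c3) τ (c1≈0 , c2≈0) = x∙y⁻¹≈ε⇒x≈y _ _ (zero-combination₂ (τ * τ) τ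
    (solve 5 (λ τ c0 c1 c2 c3 → c0 :* (τ :* τ :* τ) :+ c1 :* (τ :* τ) :+ c2 :* τ :+ c3 :* :1
                :- (c0 :* (τ :* τ :* τ) :+ c3) := (τ :* τ) :* c1 :+ τ :* c2) refl τ c0 c1 c2 c3)
    c1≈0 c2≈0)

  ⊙P∞ : ∀ cf → cf ⊙ P nothing ≈ x0 cf
  ⊙P∞ (v4 c0 c1 c2 c3) = solve 4 (λ c0 c1 c2 c3 → c0 :* :1 :+ c1 :* :0 :+ c2 :* :0 :+ c3 :* :0 := c0) refl c0 c1 c2 c3

  P∈ThroughAxis⇒x0≉0 : ∀ cf τ → IsPlane cf → ThroughAxis cf → P (just τ) ∈π cf → ¬ x0 cf ≈ 0#
  P∈ThroughAxis⇒x0≉0 cf@(v4 c0 c1 c2 c3) τ isPlane ax P∈ c0≈0 = isPlane (c0≈0 , proj₁ ax , proj₂ ax ,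
    zero-combination₂ 1# (- (τ * τ * τ))
      (solve 3 (λ c0 c3 s → c3 := :1 :* (c0 :* s :+ c3) :+ (:- s) :* c0) refl c0 c3 (τ * τ * τ))
      (trans (sym (ThroughAxis⇒⊙P cf τ ax)) P∈) c0≈0)

  -- A plane c₀x₀ + c₃x₃ = 0 through the axis meets C where c₀t³ + c₃ = 0, so in
  -- at most one point, as cubing is injective.
  ThroughAxis⇒C-point-unique : ∀ cf → IsPlane cf → ThroughAxis cf →
                               ∀ t₁ t₂ → P t₁ ∈π cf → P t₂ ∈π cf → t₁ ≈ₚ t₂
  ThroughAxis⇒C-point-unique cf@(v4 c0 c1 c2 c3) isPlane ax (just τ₁) (just τ₂) P₁∈ P₂∈ =
    just (cube-injective (x∙y⁻¹≈ε⇒x≈y _ _ (x*y≈0⇒y≈0 (P∈ThroughAxis⇒x0≉0 cf τ₁ isPlane ax P₁∈)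
      (zero-combination₂ 1# (- 1#)
        (solve 4 (λ c0 c3 s₁ s₂ → c0 :* (s₁ :- s₂) := :1 :* (c0 :* s₁ :+ c3) :+ (:- :1) :* (c0 :* s₂ :+ c3))
          refl c0 c3 (τ₁ * τ₁ * τ₁) (τ₂ * τ₂ * τ₂))
        (trans (sym (ThroughAxis⇒⊙P cf τ₁ ax)) P₁∈) (trans (sym (ThroughAxis⇒⊙P cf τ₂ ax)) P₂∈)))))
  ThroughAxis⇒C-point-unique cf isPlane ax (just τ₁) nothing P₁∈ P∞∈ =
    ⊥-elim (P∈ThroughAxis⇒x0≉0 cf τ₁ isPlane ax P₁∈ (trans (sym (⊙P∞ cf)) P∞∈))
  ThroughAxis⇒C-point-unique cf isPlane ax nothing (just τ₂) P∞∈ P₂∈ =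
    ⊥-elim (P∈ThroughAxis⇒x0≉0 cf τ₂ isPlane ax P₂∈ (trans (sym (⊙P∞ cf)) P∞∈))
  ThroughAxis⇒C-point-unique cf isPlane ax nothing nothing _ _ = nothing

  P∈Osc : ∀ t → P t ∈π Osc t
  P∈Osc (just τ) = trans (Osc⊙P τ τ) (solve 1 (λ τ → (τ :- τ) :* (τ :- τ) :* (τ :- τ) := :0) refl τ)
  P∈Osc nothing  = solve 0 (:0 :* :1 :+ :0 :* :0 :+ :0 :* :0 :+ :1 :* :0 := :0) refl

  CPointIn : V4 → V4 → Set (c ⊔ ℓ)
  CPointIn cf x = IsPoint x × OnC x × (x ∈π cf)

  nonzero-multiple⇒≉0 : ∀ {u w a} → NonZeroV u → u ≈v (a · w) → ¬ a ≈ 0#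
  nonzero-multiple⇒≉0 u≉0 u≈aw a≈0 = u≉0 (·-zero u≈aw a≈0)

  ThroughAxis⇒CPoint-unique : ∀ cf → IsPlane cf → ThroughAxis cf → ∀ {x y} → CPointIn cf x → CPointIn cf y → x ∼ y
  ThroughAxis⇒CPoint-unique cf isPlane ax {x} (x≉0 , (t₁ , a , x≈) , x∈) (y≉0 , (t₂ , b , y≈) , y∈) =
    b * a⁻¹ ,
    ≈v-trans y≈ (≈v-trans (·-cong refl (≈v-trans (P-cong (≈ₚ-sym t₁≈t₂)) (·-invert x≈ a≉0))) (·-assoc b a⁻¹ x))
    where
    a≉0 = nonzero-multiple⇒≉0 x≉0 x≈
    b≉0 = nonzero-multiple⇒≉0 y≉0 y≈
    a⁻¹ = inv a a≉0
    t₁≈t₂ = ThroughAxis⇒C-point-unique cf isPlane ax t₁ t₂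
              (∈π-·ˡ⁻ a≉0 (∈π-respˡ x≈ x∈)) (∈π-·ˡ⁻ b≉0 (∈π-respˡ y≈ y∈))

  ThroughAxis⇒CPoint-exists : ∀ cf → IsPlane cf → ThroughAxis cf → ∃[ x ] CPointIn cf x
  ThroughAxis⇒CPoint-exists cf isPlane ax with ThroughAxis⇒Γ cf isPlane ax
  ... | _ , t , cf∼ = P t , P-isPoint t , P-onC t , ∈π-∼ cf∼ (P∈Osc t)

  planes-through-axis : ∀ cf → axis ⊆π cf → ¬ IsdC 2 cf × ¬ IsdC 3 cf × ¬ Is1barC cf × ¬ IsdC 0 cf
  planes-through-axis cf axis⊆ =
    (λ (isPlane , count) → 2≰1 (HasCount-≤1 (ThroughAxis⇒CPoint-unique cf isPlane ax) count)) ,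
    (λ (isPlane , count) → 3≰1 (HasCount-≤1 (ThroughAxis⇒CPoint-unique cf isPlane ax) count)) ,
    (λ (isPlane , ¬Γ , _) → ¬Γ (ThroughAxis⇒Γ cf isPlane ax)) ,
    (λ (isPlane , count) → 1≰0 (HasCount-≥1 (ThroughAxis⇒CPoint-exists cf isPlane ax) count))
    where
    open Counting _∼_
    ax = axis⊆π⇒ThroughAxis cf axis⊆
    2≰1 : ¬ 2 ℕ.≤ 1
    2≰1 (s≤s ())
    3≰1 : ¬ 3 ℕ.≤ 1
    3≰1 (s≤s ())
    1≰0 : ¬ 1 ℕ.≤ 0
    1≰0 ()

  -- Coordinates on an osculating plane

  record V3 : Set c where
    constructor v3
    field y1 y2 y3 : Carrier
  open V3

  _≈₃_ : V3 → V3 → Set ℓ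
  X ≈₃ Y = (y1 X ≈ y1 Y) × (y2 X ≈ y2 Y) × (y3 X ≈ y3 Y)

  ≈₃-refl : ∀ {X} → X ≈₃ X
  ≈₃-refl = refl , refl , refl

  ≈₃-sym : ∀ {X Y} → X ≈₃ Y → Y ≈₃ X
  ≈₃-sym (e₁ , e₂ , e₃) = sym e₁ , sym e₂ , sym e₃

  ≈₃-trans : ∀ {X Y Z} → X ≈₃ Y → Y ≈₃ Z → X ≈₃ Z
  ≈₃-trans (e₁ , e₂ , e₃) (f₁ , f₂ , f₃) = trans e₁ f₁ , trans e₂ f₂ , trans e₃ f₃

  _·₃_ : Carrier → V3 → V3
  a ·₃ X = v3 (a * y1 X) (a * y2 X) (a * y3 X)

  ·₃-congˡ : ∀ a {X Y} → X ≈₃ Y → (a ·₃ X) ≈₃ (a ·₃ Y)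
  ·₃-congˡ a (e₁ , e₂ , e₃) = *-congˡ e₁ , *-congˡ e₂ , *-congˡ e₃

  _⊕₃_ : V3 → V3 → V3
  X ⊕₃ Y = v3 (y1 X + y1 Y) (y2 X + y2 Y) (y3 X + y3 Y)

  zero₃ : V3
  zero₃ = v3 0# 0# 0#

  Independent₃ : V3 → V3 → Set (c ⊔ ℓ)
  Independent₃ X Y = ∀ α β → ((α ·₃ X) ⊕₃ (β ·₃ Y)) ≈₃ zero₃ → (α ≈ 0#) × (β ≈ 0#)

  Span₃ : V3 → V3 → V3 → Set (c ⊔ ℓ)
  Span₃ Z X Y = ∃[ α ] ∃[ β ] (Z ≈₃ ((α ·₃ X) ⊕₃ (β ·₃ Y)))

  _⊙₃_ : V3 → V3 → Carrier
  N ⊙₃ Z = y1 N * y1 Z + y2 N * y2 Z + y3 N * y3 Z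

  ⊙₃-cong : ∀ {N N′ Z Z′} → N ≈₃ N′ → Z ≈₃ Z′ → N ⊙₃ Z ≈ N′ ⊙₃ Z′
  ⊙₃-cong (e₁ , e₂ , e₃) (f₁ , f₂ , f₃) = +-cong (+-cong (*-cong e₁ f₁) (*-cong e₂ f₂)) (*-cong e₃ f₃)

  ⊙₃-·ˡ : ∀ a N Z → (a ·₃ N) ⊙₃ Z ≈ a * (N ⊙₃ Z)
  ⊙₃-·ˡ a N Z = solve 7 (λ a n₁ n₂ n₃ z₁ z₂ z₃ → a :* n₁ :* z₁ :+ a :* n₂ :* z₂ :+ a :* n₃ :* z₃
      := a :* (n₁ :* z₁ :+ n₂ :* z₂ :+ n₃ :* z₃)) refl a (y1 N) (y2 N) (y3 N) (y1 Z) (y2 Z) (y3 Z)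

  ⊙₃-·ʳ : ∀ a N Z → N ⊙₃ (a ·₃ Z) ≈ a * (N ⊙₃ Z)
  ⊙₃-·ʳ a N Z = solve 7 (λ a n₁ n₂ n₃ z₁ z₂ z₃ → n₁ :* (a :* z₁) :+ n₂ :* (a :* z₂) :+ n₃ :* (a :* z₃)
      := a :* (n₁ :* z₁ :+ n₂ :* z₂ :+ n₃ :* z₃)) refl a (y1 N) (y2 N) (y3 N) (y1 Z) (y2 Z) (y3 Z)

  ⊙₃-Span₃ : ∀ {N Z X Y} → Span₃ Z X Y → N ⊙₃ X ≈ 0# → N ⊙₃ Y ≈ 0# → N ⊙₃ Z ≈ 0#
  ⊙₃-Span₃ {N} {Z} {X} {Y} (α , β , Z≈) = zero-combination₂ α β (trans (⊙₃-cong ≈₃-refl Z≈)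
    (solve 11 (λ n₁ n₂ n₃ α x₁ x₂ x₃ β z₁ z₂ z₃ →
       n₁ :* (α :* x₁ :+ β :* z₁) :+ n₂ :* (α :* x₂ :+ β :* z₂) :+ n₃ :* (α :* x₃ :+ β :* z₃)
       := α :* (n₁ :* x₁ :+ n₂ :* x₂ :+ n₃ :* x₃) :+ β :* (n₁ :* z₁ :+ n₂ :* z₂ :+ n₃ :* z₃))
       refl (y1 N) (y2 N) (y3 N) α (y1 X) (y2 X) (y3 X) β (y1 Y) (y2 Y) (y3 Y)))

  cross : V3 → V3 → V3
  cross X Y = v3 (y2 X * y3 Y - y3 X * y2 Y) (y3 X * y1 Y - y1 X * y3 Y) (y1 X * y2 Y - y2 X * y1 Y)

  cross-⊙₃ˡ : ∀ X Y → cross X Y ⊙₃ X ≈ 0#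
  cross-⊙₃ˡ X Y = solve 6 (λ x₁ x₂ x₃ z₁ z₂ z₃ →
    (x₂ :* z₃ :- x₃ :* z₂) :* x₁ :+ (x₃ :* z₁ :- x₁ :* z₃) :* x₂ :+ (x₁ :* z₂ :- x₂ :* z₁) :* x₃ := :0)
    refl (y1 X) (y2 X) (y3 X) (y1 Y) (y2 Y) (y3 Y)

  cross-⊙₃ʳ : ∀ X Y → cross X Y ⊙₃ Y ≈ 0#
  cross-⊙₃ʳ X Y = solve 6 (λ x₁ x₂ x₃ z₁ z₂ z₃ →
    (x₂ :* z₃ :- x₃ :* z₂) :* z₁ :+ (x₃ :* z₁ :- x₁ :* z₃) :* z₂ :+ (x₁ :* z₂ :- x₂ :* z₁) :* z₃ := :0)
    refl (y1 X) (y2 X) (y3 X) (y1 Y) (y2 Y) (y3 Y)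

  minor≈0⇒relation : ∀ a b c d → a * d - b * c ≈ 0# → c * b + (- a) * d ≈ 0#
  minor≈0⇒relation a b c d = zero-combination₁ (- 1#)
    (solve 4 (λ a b c d → c :* b :+ (:- a) :* d := (:- :1) :* (a :* d :- b :* c)) refl a b c d)

  minor-antisym : ∀ {a b c d} → b * c - a * d ≈ 0# → a * d - b * c ≈ 0#
  minor-antisym {a} {b} {c} {d} e =
    -x≈0⇒x≈0 (trans (solve 4 (λ a b c d → :- (a :* d :- b :* c) := b :* c :- a :* d) refl a b c d) e)

  self-relation : ∀ c a → c * a + (- a) * c ≈ 0#
  self-relation c a = solve 2 (λ c a → c :* a :+ (:- a) :* c := :0) refl c a

  -- If the cross product vanishes, a nonzero coordinate xᵢ of X gives the relation yᵢX - xᵢY = 0.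
  cross-nonzero : ∀ X Y → Independent₃ X Y → ¬ (cross X Y ≈₃ zero₃)
  cross-nonzero X@(v3 x₁ x₂ x₃) Y@(v3 z₁ z₂ z₃) ind (c₁≈0 , c₂≈0 , c₃≈0) with x₁ ≟ 0# | x₂ ≟ 0# | x₃ ≟ 0#
  ... | no x₁≉0 | _ | _ = x₁≉0 (-x≈0⇒x≈0 (proj₂ (ind z₁ (- x₁)
        (self-relation z₁ x₁ , minor≈0⇒relation x₁ x₂ z₁ z₂ c₃≈0 ,
         minor≈0⇒relation x₁ x₃ z₁ z₃ (minor-antisym c₂≈0)))))
  ... | yes _ | no x₂≉0 | _ = x₂≉0 (-x≈0⇒x≈0 (proj₂ (ind z₂ (- x₂)
        (minor≈0⇒relation x₂ x₁ z₂ z₁ (minor-antisym c₃≈0) , self-relation z₂ x₂ ,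
         minor≈0⇒relation x₂ x₃ z₂ z₃ c₁≈0))))
  ... | yes _ | yes _ | no x₃≉0 = x₃≉0 (-x≈0⇒x≈0 (proj₂ (ind z₃ (- x₃)
        (minor≈0⇒relation x₃ x₁ z₃ z₁ c₂≈0 , minor≈0⇒relation x₃ x₂ z₃ z₂ (minor-antisym c₁≈0) ,
         self-relation z₃ x₃))))
  ... | yes x₁≈0 | yes x₂≈0 | yes x₃≈0 = 1≉0 (proj₁ (ind 1# 0# (X≈0 x₁≈0 , X≈0 x₂≈0 , X≈0 x₃≈0)))
    where
    X≈0 : ∀ {x z} → x ≈ 0# → 1# * x + 0# * z ≈ 0#
    X≈0 {x} {z} x≈0 = trans (solve 2 (λ x z → :1 :* x :+ :0 :* z := x) refl x z) x≈0

  -- A point of the plane Osc t is determined by (x₁, x₂, x₃) when t is finite (then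
  -- x₀ = t³x₃), and by (x₁, x₂, x₀) when t = ∞ (then x₃ = 0).
  embed : Param → V3 → V4
  embed (just τ) X = v4 (τ * τ * τ * y3 X) (y1 X) (y2 X) (y3 X)
  embed nothing  X = v4 (y3 X) (y1 X) (y2 X) 0#

  coords : Param → V4 → V3
  coords (just _) u = v3 (x1 u) (x2 u) (x3 u)
  coords nothing  u = v3 (x1 u) (x2 u) (x0 u)

  P-coords : Param → V3
  P-coords (just τ) = v3 (τ * τ) τ 1#
  P-coords nothing  = v3 0# 0# 1#

  embed∈Osc : ∀ t X → embed t X ∈π Osc t
  embed∈Osc (just τ) X = solve 4 (λ τ a b d → :1 :* (τ :* τ :* τ :* d) :+ (:- ((:1 :+ :1 :+ :1) :* τ)) :* a
      :+ ((:1 :+ :1 :+ :1) :* (τ :* τ)) :* b :+ (:- (τ :* τ :* τ)) :* d := :0) refl τ (y1 X) (y2 X) (y3 X)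
  embed∈Osc nothing X = solve 3 (λ a b d → :0 :* d :+ :0 :* a :+ :0 :* b :+ :1 :* :0 := :0) refl (y1 X) (y2 X) (y3 X)

  ∈Osc⇒≈embed : ∀ t z → z ∈π Osc t → z ≈v embed t (coords t z)
  ∈Osc⇒≈embed (just τ) (v4 z0 z1 z2 z3) z∈ = x∙y⁻¹≈ε⇒x≈y _ _ (trans (solve 5 (λ τ z0 z1 z2 z3 →
      z0 :- τ :* τ :* τ :* z3 := :1 :* z0 :+ (:- ((:1 :+ :1 :+ :1) :* τ)) :* z1
      :+ ((:1 :+ :1 :+ :1) :* (τ :* τ)) :* z2 :+ (:- (τ :* τ :* τ)) :* z3) refl τ z0 z1 z2 z3) z∈) ,
    refl , refl , refl
  ∈Osc⇒≈embed nothing (v4 z0 z1 z2 z3) z∈ = refl , refl , refl ,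
    trans (solve 4 (λ z0 z1 z2 z3 → z3 := :0 :* z0 :+ :0 :* z1 :+ :0 :* z2 :+ :1 :* z3) refl z0 z1 z2 z3) z∈

  P≈embed-P-coords : ∀ t → P t ≈v embed t (P-coords t)
  P≈embed-P-coords (just τ) = sym (*-identityʳ _) , refl , refl , refl
  P≈embed-P-coords nothing  = ≈v-refl

  embed-cong : ∀ t {X Y} → X ≈₃ Y → embed t X ≈v embed t Y
  embed-cong (just τ) (e₁ , e₂ , e₃) = *-congˡ e₃ , e₁ , e₂ , e₃
  embed-cong nothing  (e₁ , e₂ , e₃) = e₃ , e₁ , e₂ , refl

  embed-linear : ∀ t α X β Y → embed t ((α ·₃ X) ⊕₃ (β ·₃ Y)) ≈v ((α · embed t X) ⊕ (β · embed t Y))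
  embed-linear (just τ) α X β Y = solve 5 (λ τ α x β y → τ :* τ :* τ :* (α :* x :+ β :* y)
      := α :* (τ :* τ :* τ :* x) :+ β :* (τ :* τ :* τ :* y)) refl τ α (y3 X) β (y3 Y) , refl , refl , refl
  embed-linear nothing α X β Y = refl , refl , refl , solve 2 (λ α β → :0 := α :* :0 :+ β :* :0) refl α β

  embed-zero : ∀ t → embed t zero₃ ≈v zeroV
  embed-zero (just τ) = zeroʳ _ , refl , refl , refl
  embed-zero nothing  = ≈v-refl

  coords-cong : ∀ t {u w} → u ≈v w → coords t u ≈₃ coords t w
  coords-cong (just _) (_ , e₁ , e₂ , e₃)  = e₁ , e₂ , e₃
  coords-cong nothing  (e₀ , e₁ , e₂ , _) = e₁ , e₂ , e₀

  coords-embed : ∀ t X → coords t (embed t X) ≈₃ X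
  coords-embed (just _) X = ≈₃-refl
  coords-embed nothing  X = ≈₃-refl

  coords-linear : ∀ t α u β w → coords t ((α · u) ⊕ (β · w)) ≈₃ ((α ·₃ coords t u) ⊕₃ (β ·₃ coords t w))
  coords-linear (just _) α u β w = ≈₃-refl
  coords-linear nothing  α u β w = ≈₃-refl

  coords-· : ∀ t a u → coords t (a · u) ≈₃ (a ·₃ coords t u)
  coords-· (just _) a u = ≈₃-refl
  coords-· nothing  a u = ≈₃-refl

  coords-combination : ∀ t α X β Y → coords t ((α · embed t X) ⊕ (β · embed t Y)) ≈₃ ((α ·₃ X) ⊕₃ (β ·₃ Y))
  coords-combination (just _) α X β Y = ≈₃-refl
  coords-combination nothing  α X β Y = ≈₃-refl

  ∈ℓ⇒Span₃ : ∀ t {x} X Y → x ∈ℓ (embed t X , embed t Y) → Span₃ (coords t x) X Y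
  ∈ℓ⇒Span₃ t X Y (α , β , x≈) = α , β , ≈₃-trans (coords-cong t x≈) (coords-combination t α X β Y)

  Span₃⇒∈ℓ : ∀ t {z} X Y → z ∈π Osc t → Span₃ (coords t z) X Y → z ∈ℓ (embed t X , embed t Y)
  Span₃⇒∈ℓ t {z} X Y z∈ (α , β , z≈) =
    α , β , ≈v-trans (∈Osc⇒≈embed t z z∈) (≈v-trans (embed-cong t z≈) (embed-linear t α X β Y))

  Independent₃⇒Independent : ∀ t X Y → Independent₃ X Y → Independent (embed t X) (embed t Y)
  Independent₃⇒Independent t X Y ind α β αX+βY≈0 = ind α β (≈₃-trans
    (≈₃-sym (coords-combination t α X β Y)) (≈₃-trans (coords-cong t αX+βY≈0) (coords-zero t)))
    where
    coords-zero : ∀ t → coords t zeroV ≈₃ zero₃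
    coords-zero (just _) = ≈₃-refl
    coords-zero nothing  = ≈₃-refl

  ∈ℓ⇒⊙₃≈0 : ∀ t X Y N V → embed t V ∈ℓ (embed t X , embed t Y) →
             N ⊙₃ X ≈ 0# → N ⊙₃ Y ≈ 0# → N ⊙₃ V ≈ 0#
  ∈ℓ⇒⊙₃≈0 t X Y N V V∈ = ⊙₃-Span₃ (Span-resp (∈ℓ⇒Span₃ t X Y V∈))
    where
    Span-resp : Span₃ (coords t (embed t V)) X Y → Span₃ V X Y
    Span-resp (α , β , e) = α , β , ≈₃-trans (≈₃-sym (coords-embed t V)) e

  -- Lines of a plane with coordinates y₁, y₂, y₃ other than the axis y₃ = 0 meet it in
  -- (1 : m : 0) or in (0 : 1 : 0), and their point with y₃ = 1 is Q = (A, B, 1) shifted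
  -- along y₂, resp. y₁, by e; e is the value at Q of the normal below, so e ≉ 0 says
  -- exactly that the line misses Q.
  module Pencil (A B : Carrier) where

    Q : V3
    Q = v3 A B 1#

    axis₁ : Carrier → V3
    axis₁ m = v3 1# m 0#

    axis∞ : V3
    axis∞ = v3 0# 1# 0#

    farA : Carrier → Carrier → V3
    farA m e = v3 A (B + e) 1#

    farB : Carrier → V3
    farB e = v3 (A + e) B 1#

    normalA : Carrier → Carrier → V3
    normalA m e = v3 m (- 1#) (B + e - m * A)

    normalB : Carrier → V3
    normalB e = v3 1# 0# (- (A + e))

    normal-axis : V3
    normal-axis = v3 0# 0# 1#

    normalA⊙axis₁ : ∀ m e m′ → normalA m e ⊙₃ axis₁ m′ ≈ m - m′
    normalA⊙axis₁ m e m′ = solve 5 (λ A B m e m′ → m :* :1 :+ (:- :1) :* m′ :+ (B :+ e :- m :* A) :* :0 := m :- m′)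
      refl A B m e m′

    normalA⊙farA : ∀ m e m′ e′ → normalA m e ⊙₃ farA m′ e′ ≈ e - e′
    normalA⊙farA m e m′ e′ = solve 5 (λ A B m e e′ → m :* A :+ (:- :1) :* (B :+ e′) :+ (B :+ e :- m :* A) :* :1 := e :- e′)
      refl A B m e e′

    normalA⊙axis∞ : ∀ m e → normalA m e ⊙₃ axis∞ ≈ - 1#
    normalA⊙axis∞ m e = solve 4 (λ A B m e → m :* :0 :+ (:- :1) :* :1 :+ (B :+ e :- m :* A) :* :0 := :- :1) refl A B m e

    normalA⊙Q : ∀ m e → normalA m e ⊙₃ Q ≈ e
    normalA⊙Q m e = solve 4 (λ A B m e → m :* A :+ (:- :1) :* B :+ (B :+ e :- m :* A) :* :1 := e) refl A B m e

    normalB⊙farB : ∀ e e′ → normalB e ⊙₃ farB e′ ≈ e′ - e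
    normalB⊙farB e e′ = solve 4 (λ A B e e′ → :1 :* (A :+ e′) :+ :0 :* B :+ (:- (A :+ e)) :* :1 := e′ :- e) refl A B e e′

    normalB⊙axis∞ : ∀ e → normalB e ⊙₃ axis∞ ≈ 0#
    normalB⊙axis∞ e = solve 3 (λ A B e → :1 :* :0 :+ :0 :* :1 :+ (:- (A :+ e)) :* :0 := :0) refl A B e

    normalB⊙Q : ∀ e → normalB e ⊙₃ Q ≈ - e
    normalB⊙Q e = solve 3 (λ A B e → :1 :* A :+ :0 :* B :+ (:- (A :+ e)) :* :1 := :- e) refl A B e

    normalA⊥lineA : ∀ m e → (normalA m e ⊙₃ axis₁ m ≈ 0#) × (normalA m e ⊙₃ farA m e ≈ 0#)
    normalA⊥lineA m e = trans (normalA⊙axis₁ m e m) (-‿inverseʳ m) , trans (normalA⊙farA m e m e) (-‿inverseʳ e)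

    normalB⊥lineB : ∀ e → (normalB e ⊙₃ axis∞ ≈ 0#) × (normalB e ⊙₃ farB e ≈ 0#)
    normalB⊥lineB e = normalB⊙axis∞ e , trans (normalB⊙farB e e) (-‿inverseʳ e)

    normalA-kernel : ∀ m e Z → normalA m e ⊙₃ Z ≈ 0# → Span₃ Z (axis₁ m) (farA m e)
    normalA-kernel m e (v3 z₁ z₂ z₃) Z⊥ = z₁ - z₃ * A , z₃ ,
      solve 3 (λ A z₁ z₃ → z₁ := (z₁ :- z₃ :* A) :* :1 :+ z₃ :* A) refl A z₁ z₃ ,
      x∙y⁻¹≈ε⇒x≈y _ _ (zero-combination₁ (- 1#) (solve 7 (λ A B m e z₁ z₂ z₃ →
          z₂ :- ((z₁ :- z₃ :* A) :* m :+ z₃ :* (B :+ e))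
          := (:- :1) :* (m :* z₁ :+ (:- :1) :* z₂ :+ (B :+ e :- m :* A) :* z₃)) refl A B m e z₁ z₂ z₃) Z⊥) ,
      solve 3 (λ A z₁ z₃ → z₃ := (z₁ :- z₃ :* A) :* :0 :+ z₃ :* :1) refl A z₁ z₃

    normalB-kernel : ∀ e Z → normalB e ⊙₃ Z ≈ 0# → Span₃ Z axis∞ (farB e)
    normalB-kernel e (v3 z₁ z₂ z₃) Z⊥ = z₂ - z₃ * B , z₃ ,
      x∙y⁻¹≈ε⇒x≈y _ _ (zero-combination₁ 1# (solve 6 (λ A B e z₁ z₂ z₃ →
          z₁ :- ((z₂ :- z₃ :* B) :* :0 :+ z₃ :* (A :+ e))
          := :1 :* (:1 :* z₁ :+ :0 :* z₂ :+ (:- (A :+ e)) :* z₃)) refl A B e z₁ z₂ z₃) Z⊥) ,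
      solve 3 (λ B z₂ z₃ → z₂ := (z₂ :- z₃ :* B) :* :1 :+ z₃ :* B) refl B z₂ z₃ ,
      solve 3 (λ B z₂ z₃ → z₃ := (z₂ :- z₃ :* B) :* :0 :+ z₃ :* :1) refl B z₂ z₃

    normal-axis-kernel : ∀ Z → normal-axis ⊙₃ Z ≈ 0# → Span₃ Z (v3 1# 0# 0#) (v3 0# 1# 0#)
    normal-axis-kernel (v3 z₁ z₂ z₃) Z⊥ = z₁ , z₂ ,
      solve 2 (λ z₁ z₂ → z₁ := z₁ :* :1 :+ z₂ :* :0) refl z₁ z₂ ,
      solve 2 (λ z₁ z₂ → z₂ := z₁ :* :0 :+ z₂ :* :1) refl z₁ z₂ ,
      x∙y⁻¹≈ε⇒x≈y _ _ (zero-combination₁ 1# (solve 3 (λ z₁ z₂ z₃ → z₃ :- (z₁ :* :0 :+ z₂ :* :0)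
          := :1 :* (:0 :* z₁ :+ :0 :* z₂ :+ :1 :* z₃)) refl z₁ z₂ z₃) Z⊥)

    lineA-independent : ∀ m e → Independent₃ (axis₁ m) (farA m e)
    lineA-independent m e α β (e₁ , _ , e₃) =
      zero-combination₂ 1# (- A)
        (solve 3 (λ A α β → α := :1 :* (α :* :1 :+ β :* A) :+ (:- A) :* (α :* :0 :+ β :* :1)) refl A α β) e₁ e₃ ,
      trans (solve 2 (λ α β → β := α :* :0 :+ β :* :1) refl α β) e₃

    lineB-independent : ∀ e → Independent₃ axis∞ (farB e)
    lineB-independent e α β (_ , e₂ , e₃) =
      zero-combination₂ 1# (- B)
        (solve 3 (λ B α β → α := :1 :* (α :* :1 :+ β :* B) :+ (:- B) :* (α :* :0 :+ β :* :1)) refl B α β) e₂ e₃ ,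
      trans (solve 2 (λ α β → β := α :* :0 :+ β :* :1) refl α β) e₃

  -- The EA-lines of an osculating plane

  module PencilAt (t : Param) = Pencil (y1 (P-coords t)) (y2 (P-coords t))

  P-coords≈Q : ∀ t → P-coords t ≈₃ PencilAt.Q t
  P-coords≈Q (just _) = ≈₃-refl
  P-coords≈Q nothing  = ≈₃-refl

  lineA : Param → Carrier → Carrier → LinePair
  lineA t m e = embed t (PencilAt.axis₁ t m) , embed t (PencilAt.farA t m e)

  lineB : Param → Carrier → LinePair
  lineB t e = embed t (PencilAt.axis∞ t) , embed t (PencilAt.farB t e)

  line-misses-C : ∀ t X Y N → N ⊙₃ X ≈ 0# → N ⊙₃ Y ≈ 0# → ¬ N ⊙₃ P-coords t ≈ 0# →
                  ∀ x → IsPoint x → OnC x → ¬ x ∈ℓ (embed t X , embed t Y)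
  line-misses-C t X Y N X⊥ Y⊥ Q∉ x x≉0 (t′ , a , x≈) x∈ = Q∉ (x*y≈0⇒y≈0 a≉0 (begin
    a * (N ⊙₃ P-coords t)   ≈⟨ ⊙₃-·ʳ a N _ ⟨
    N ⊙₃ (a ·₃ P-coords t)  ≈⟨ ⊙₃-cong ≈₃-refl coords-x ⟨
    N ⊙₃ coords t x         ≈⟨ ⊙₃-Span₃ (∈ℓ⇒Span₃ t X Y x∈) X⊥ Y⊥ ⟩
    0#                      ∎))
    where
    a≉0 = nonzero-multiple⇒≉0 x≉0 x≈
    P∈ : P t′ ∈π Osc t
    P∈ = ∈π-·ˡ⁻ a≉0 (∈π-respˡ x≈ (∈ℓ⇒∈π (embed∈Osc t X) (embed∈Osc t Y) x∈))
    coords-x : coords t x ≈₃ (a ·₃ P-coords t)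
    coords-x = ≈₃-trans
      (coords-cong t (≈v-trans x≈ (·-cong refl (≈v-trans (P-cong (P∈Osc⇒≈ₚ t t′ P∈)) (P≈embed-P-coords t)))))
      (≈₃-trans (coords-· t a _) (·₃-congˡ a (coords-embed t _)))

  off-axis-line≢axis : ∀ t X a b → ¬ ((embed t X , embed t (v3 a b 1#)) ≗ℓ axis)
  off-axis-line≢axis (just τ) X a b (_ , _ , _ , (α , β , (_ , _ , _ , 1≈))) =
    1≉0 (trans 1≈ (solve 2 (λ α β → α :* :0 :+ β :* :0 := :0) refl α β))
  off-axis-line≢axis nothing X a b (_ , _ , _ , (α , β , (1≈ , _))) =
    1≉0 (trans 1≈ (solve 2 (λ α β → α :* :0 :+ β :* :0 := :0) refl α β))

  embed-on-axis : ∀ t a b → embed t (v3 a b 0#) ∈ℓ axis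
  embed-on-axis (just τ) a b with axis-combination a b
  ... | 0≈ , a≈ , b≈ = a , b , trans (zeroʳ _) 0≈ , a≈ , b≈ , 0≈
  embed-on-axis nothing a b with axis-combination a b
  ... | 0≈ , a≈ , b≈ = a , b , 0≈ , a≈ , b≈ , 0≈

  embed-isPoint : ∀ t X → ¬ ((y1 X ≈ 0#) × (y2 X ≈ 0#)) → IsPoint (embed t X)
  embed-isPoint (just τ) X X≉0 (_ , e₁ , e₂ , _) = X≉0 (e₁ , e₂)
  embed-isPoint nothing  X X≉0 (_ , e₁ , e₂ , _) = X≉0 (e₁ , e₂)

  -- The second spanning vector is kept off the axis, with y₃ = 1; this point singles out
  -- the Γ-plane of the line.
  EALineIn : Param → LinePair → Set (c ⊔ ℓ)
  EALineIn t L = IsEALine L × (L ⊆π Osc t) × (∃[ a ] ∃[ b ] (proj₂ L ≡ embed t (v3 a b 1#)))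

  EALineIn-intro : ∀ t a₁ b₁ a b N → Independent₃ (v3 a₁ b₁ 0#) (v3 a b 1#) →
                   N ⊙₃ v3 a₁ b₁ 0# ≈ 0# → N ⊙₃ v3 a b 1# ≈ 0# → ¬ N ⊙₃ P-coords t ≈ 0# →
                   ¬ ((a₁ ≈ 0#) × (b₁ ≈ 0#)) → EALineIn t (embed t (v3 a₁ b₁ 0#) , embed t (v3 a b 1#))
  EALineIn-intro t a₁ b₁ a b N ind X⊥ Y⊥ Q∉ X≉0 =
    (Independent₃⇒Independent t _ _ ind , line-misses-C t _ _ N X⊥ Y⊥ Q∉ , off-axis-line≢axis t _ a b ,
      (embed t (v3 a₁ b₁ 0#) , embed-isPoint t _ X≉0 , ∈ℓ-first _ _ , embed-on-axis t a₁ b₁)) ,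
    (embed∈Osc t _ , embed∈Osc t _) , a , b , ≡.refl

  lineA-EA : ∀ t m e → ¬ e ≈ 0# → EALineIn t (lineA t m e)
  lineA-EA t m e e≉0 = EALineIn-intro t 1# m _ _ (normalA m e) (lineA-independent m e)
    (proj₁ (normalA⊥lineA m e)) (proj₂ (normalA⊥lineA m e))
    (λ Q⊥ → e≉0 (trans (sym (normalA⊙Q m e)) (trans (sym (⊙₃-cong ≈₃-refl (P-coords≈Q t))) Q⊥)))
    (λ (1≈0 , _) → 1≉0 1≈0)
    where open PencilAt t

  lineB-EA : ∀ t e → ¬ e ≈ 0# → EALineIn t (lineB t e)
  lineB-EA t e e≉0 = EALineIn-intro t 0# 1# _ _ (normalB e) (lineB-independent e)
    (proj₁ (normalB⊥lineB e)) (proj₂ (normalB⊥lineB e))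
    (λ Q⊥ → e≉0 (-x≈0⇒x≈0 (trans (sym (normalB⊙Q e)) (trans (sym (⊙₃-cong ≈₃-refl (P-coords≈Q t))) Q⊥))))
    (λ (_ , 1≈0) → 1≉0 1≈0)
    where open PencilAt t

  lineA-injective : ∀ t m e m′ e′ → lineA t m e ≗ℓ lineA t m′ e′ → (m ≈ m′) × (e ≈ e′)
  lineA-injective t m e m′ e′ (axis₁∈ , farA∈ , _) =
    x∙y⁻¹≈ε⇒x≈y _ _ (trans (sym (normalA⊙axis₁ m e m′)) (on-lineA axis₁∈)) ,
    x∙y⁻¹≈ε⇒x≈y _ _ (trans (sym (normalA⊙farA m e m′ e′)) (on-lineA farA∈))
    where
    open PencilAt t
    on-lineA : ∀ {V} → embed t V ∈ℓ lineA t m e → normalA m e ⊙₃ V ≈ 0#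
    on-lineA V∈ = ∈ℓ⇒⊙₃≈0 t _ _ (normalA m e) _ V∈ (proj₁ (normalA⊥lineA m e)) (proj₂ (normalA⊥lineA m e))

  lineB-injective : ∀ t e e′ → lineB t e ≗ℓ lineB t e′ → e ≈ e′
  lineB-injective t e e′ (_ , farB∈ , _) = sym (x∙y⁻¹≈ε⇒x≈y _ _ (trans (sym (normalB⊙farB e e′))
    (∈ℓ⇒⊙₃≈0 t _ _ (normalB e) _ farB∈ (proj₁ (normalB⊥lineB e)) (proj₂ (normalB⊥lineB e)))))
    where open PencilAt t

  lineA≢lineB : ∀ t m e e′ → ¬ (lineA t m e ≗ℓ lineB t e′)
  lineA≢lineB t m e e′ (axis∞∈ , _) = 1≉0 (-x≈0⇒x≈0 (trans (sym (normalA⊙axis∞ m e))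
    (∈ℓ⇒⊙₃≈0 t _ _ (normalA m e) _ axis∞∈ (proj₁ (normalA⊥lineA m e)) (proj₂ (normalA⊥lineA m e)))))
    where open PencilAt t

  EALines : Param → List LinePair
  EALines t = concat (map (λ m → map (lineA t m) nonzeros) elements) ++ map (lineB t) nonzeros

  EALines-EA : ∀ t → All (EALineIn t) (EALines t)
  EALines-EA t = Allₚ.++⁺
    (Allₚ.concat⁺ (Allₚ.map⁺ (All.universal (λ m → Allₚ.map⁺ (All.map (lineA-EA t m _) nonzeros-≉0)) elements)))
    (Allₚ.map⁺ (All.map (lineB-EA t _) nonzeros-≉0))

  _≢ℓ_ : LinePair → LinePair → Set (c ⊔ ℓ)
  L ≢ℓ L′ = ¬ L ≗ℓ L′

  EALines-unique : ∀ t → AllPairs _≢ℓ_ (EALines t)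
  EALines-unique t = AllPairsₚ.++⁺ (AllPairsₚ.concat⁺ (Allₚ.map⁺ (All.universal A-unique elements)) A-cross) B-unique AB-cross
    where
    A-unique : ∀ m → AllPairs _≢ℓ_ (map (lineA t m) nonzeros)
    A-unique m = AllPairsₚ.map⁺ (AllPairs.map (λ e≉e′ eq → e≉e′ (proj₂ (lineA-injective t m _ m _ eq))) nonzeros-unique)
    A-cross : AllPairs (λ Ls Ls′ → All (λ L → All (L ≢ℓ_) Ls′) Ls) (map (λ m → map (lineA t m) nonzeros) elements)
    A-cross = AllPairsₚ.map⁺ (AllPairs.map (λ m≉m′ → Allₚ.map⁺ (All.universal (λ e → Allₚ.map⁺ (All.universal
                (λ e′ eq → m≉m′ (proj₁ (lineA-injective t _ e _ e′ eq))) nonzeros)) nonzeros)) distinct)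
    B-unique : AllPairs _≢ℓ_ (map (lineB t) nonzeros)
    B-unique = AllPairsₚ.map⁺ (AllPairs.map (λ e≉e′ eq → e≉e′ (lineB-injective t _ _ eq)) nonzeros-unique)
    AB-cross : All (λ L → All (L ≢ℓ_) (map (lineB t) nonzeros)) (concat (map (λ m → map (lineA t m) nonzeros) elements))
    AB-cross = Allₚ.concat⁺ (Allₚ.map⁺ (All.universal (λ m → Allₚ.map⁺ (All.universal (λ e →
                 Allₚ.map⁺ (All.universal (λ e′ → lineA≢lineB t m e e′) nonzeros)) nonzeros)) elements))

  length-EALines : ∀ t → length (EALines t) ≡ q ℕ.* q ℕ.∸ 1
  length-EALines t = ≡.trans (List.length-++ (concat (map (λ m → map (lineA t m) nonzeros) elements)))
    (≡.trans (≡.cong₂ ℕ._+_ (length-concat-map _ (λ m → List.length-map (lineA t m) nonzeros) elements)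
                            (List.length-map (lineB t) nonzeros))
             (≡.subst (λ q → q ℕ.* n ℕ.+ n ≡ q ℕ.* q ℕ.∸ 1) (≡.sym length-nonzeros) (q²-1 n)))
    where
    n = length nonzeros
    q²-1 : ∀ n → ℕ.suc n ℕ.* n ℕ.+ n ≡ ℕ.suc n ℕ.* ℕ.suc n ℕ.∸ 1
    q²-1 n = ≡.trans (ℕₚ.+-comm (n ℕ.+ n ℕ.* n) n) (≡.cong (n ℕ.+_) (≡.sym (ℕₚ.*-suc n n)))

  embed-axis-first : ∀ t → embed t (v3 1# 0# 0#) ≈v proj₁ axis
  embed-axis-first (just τ) = zeroʳ _ , refl , refl , refl
  embed-axis-first nothing  = ≈v-refl

  embed-axis-second : ∀ t → embed t (v3 0# 1# 0#) ≈v proj₂ axis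
  embed-axis-second (just τ) = zeroʳ _ , refl , refl , refl
  embed-axis-second nothing  = ≈v-refl

  -- An EA-line of Osc t has coordinate normal N = U × W; normalising the first nonzero
  -- of N₂, N₁ gives normalA or normalB, and N₁ ≈ N₂ ≈ 0 would make the line the axis.
  module EALinesComplete (t : Param) {u w} (ea : IsEALine (u , w)) (u∈ : u ∈π Osc t) (w∈ : w ∈π Osc t) where
    open PencilAt t

    U W N : V3
    U = coords t u
    W = coords t w
    N = cross U W

    Kernel : V3 → V3 → V3 → Set (c ⊔ ℓ)
    Kernel N′ X Y = ∀ Z → N′ ⊙₃ Z ≈ 0# → Span₃ Z X Y

    independent : Independent₃ U W
    independent α β αU+βW≈0 = proj₁ ea α β (≈v-trans (∈Osc⇒≈embed t _ αu+βw∈)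
      (≈v-trans (embed-cong t (≈₃-trans (coords-linear t α u β w) αU+βW≈0)) (embed-zero t)))
      where αu+βw∈ = ∈ℓ⇒∈π u∈ w∈ (α , β , ≈v-refl)

    ⊥-multiple : ∀ {N′ k} Z → N′ ≈₃ (k ·₃ N) → N ⊙₃ Z ≈ 0# → N′ ⊙₃ Z ≈ 0#
    ⊥-multiple {N′} {k} Z N′≈ N⊥Z = zero-combination₁ k (trans (⊙₃-cong N′≈ ≈₃-refl) (⊙₃-·ˡ k N Z)) N⊥Z

    line≗ : ∀ {N′ k} X Y → N′ ≈₃ (k ·₃ N) → Kernel N′ X Y → (u , w) ≗ℓ (embed t X , embed t Y)
    line≗ X Y N′≈ ker = proj₁ exchanged , proj₂ exchanged , u∈XY , w∈XY
      where
      u∈XY = Span₃⇒∈ℓ t X Y u∈ (ker U (⊥-multiple U N′≈ (cross-⊙₃ˡ U W)))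
      w∈XY = Span₃⇒∈ℓ t X Y w∈ (ker W (⊥-multiple W N′≈ (cross-⊙₃ʳ U W)))
      exchanged = span-exchange (proj₁ ea) u∈XY w∈XY

    normal-misses-P : ∀ {N′} X Y → Kernel N′ X Y → (u , w) ≗ℓ (embed t X , embed t Y) → ¬ N′ ⊙₃ P-coords t ≈ 0#
    normal-misses-P X Y ker (X∈ , Y∈ , _) P⊥ =
      proj₁ (proj₂ ea) (P t) (P-isPoint t) (P-onC t) (∈ℓ-trans P∈XY X∈ Y∈)
      where
      P∈XY : P t ∈ℓ (embed t X , embed t Y)
      P∈XY = Span₃⇒∈ℓ t X Y (∈π-respˡ (≈v-sym (P≈embed-P-coords t)) (embed∈Osc t _))
               (map₂ (map₂ (≈₃-trans (≈₃-trans (coords-cong t (P≈embed-P-coords t)) (coords-embed t _))))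
                 (ker (P-coords t) P⊥))

    in-lineAs : ¬ y2 N ≈ 0# → Any ((u , w) ≗ℓ_) (concat (map (λ m → map (lineA t m) nonzeros) elements))
    in-lineAs N₂≉0 = Anyₚ.concat⁺ (Anyₚ.map⁺ (Any.map in-lineA (complete m′)))
      where
      k = - inv (y2 N) N₂≉0
      m′ = k * y1 N
      in-lineA : ∀ {m} → m′ ≈ m → Any ((u , w) ≗ℓ_) (map (lineA t m) nonzeros)
      in-lineA {m} m′≈m = Anyₚ.map⁺ (Any.map (λ e′≈e → on-lineA _ (sym e′≈e)) (∈-nonzeros e′ e′≉0))
        where
        e′ = k * y3 N - y2 Q + m * y1 Q
        normalA≈ : ∀ e → e ≈ e′ → normalA m e ≈₃ (k ·₃ N)
        normalA≈ e e≈ = sym m′≈m ,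
          trans (-‿cong (sym (inv-inverseʳ (y2 N) N₂≉0))) (solve 2 (λ n i → :- (n :* i) := (:- i) :* n) refl (y2 N) _) ,
          trans (+-congʳ (+-congˡ e≈)) (solve 5 (λ B k n₃ m A → B :+ (k :* n₃ :- B :+ m :* A) :- m :* A := k :* n₃)
            refl (y2 Q) k (y3 N) m (y1 Q))
        on-lineA : ∀ e → e ≈ e′ → (u , w) ≗ℓ lineA t m e
        on-lineA e e≈ = line≗ _ _ (normalA≈ e e≈) (normalA-kernel m e)
        e′≉0 : ¬ e′ ≈ 0#
        e′≉0 e′≈0 = normal-misses-P _ _ (normalA-kernel m e′) (on-lineA e′ refl)
          (trans (⊙₃-cong ≈₃-refl (P-coords≈Q t)) (trans (normalA⊙Q m e′) e′≈0))

    in-lineBs : y2 N ≈ 0# → ¬ y1 N ≈ 0# → Any ((u , w) ≗ℓ_) (map (lineB t) nonzeros)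
    in-lineBs N₂≈0 N₁≉0 = Anyₚ.map⁺ (Any.map (λ e′≈e → on-lineB _ (sym e′≈e)) (∈-nonzeros e′ e′≉0))
      where
      k = inv (y1 N) N₁≉0
      e′ = - (k * y3 N) - y1 Q
      normalB≈ : ∀ e → e ≈ e′ → normalB e ≈₃ (k ·₃ N)
      normalB≈ e e≈ = sym (trans (*-comm k _) (inv-inverseʳ (y1 N) N₁≉0)) , sym (zero-combination₁ k refl N₂≈0) ,
        trans (-‿cong (+-congˡ e≈)) (solve 3 (λ A k n₃ → :- (A :+ (:- (k :* n₃) :- A)) := k :* n₃) refl (y1 Q) k (y3 N))
      on-lineB : ∀ e → e ≈ e′ → (u , w) ≗ℓ lineB t e
      on-lineB e e≈ = line≗ _ _ (normalB≈ e e≈) (normalB-kernel e)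
      e′≉0 : ¬ e′ ≈ 0#
      e′≉0 e′≈0 = normal-misses-P _ _ (normalB-kernel e′) (on-lineB e′ refl)
        (trans (⊙₃-cong ≈₃-refl (P-coords≈Q t)) (trans (normalB⊙Q e′) (trans (-‿cong e′≈0) -0#≈0#)))

    is-axis : y1 N ≈ 0# → y2 N ≈ 0# → (u , w) ≗ℓ axis
    is-axis N₁≈0 N₂≈0 = ≗ℓ-respʳ (embed-axis-first t) (embed-axis-second t) (line≗ _ _ normal-axis≈ normal-axis-kernel)
      where
      N₃≉0 : ¬ y3 N ≈ 0#
      N₃≉0 N₃≈0 = cross-nonzero U W independent (N₁≈0 , N₂≈0 , N₃≈0)
      k = inv (y3 N) N₃≉0
      normal-axis≈ : normal-axis ≈₃ (k ·₃ N)
      normal-axis≈ = sym (zero-combination₁ k refl N₁≈0) , sym (zero-combination₁ k refl N₂≈0) ,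
                     sym (trans (*-comm k _) (inv-inverseʳ (y3 N) N₃≉0))

    ∈EALines : Any ((u , w) ≗ℓ_) (EALines t)
    ∈EALines with y2 N ≟ 0# | y1 N ≟ 0#
    ... | no  N₂≉0 | _        = Anyₚ.++⁺ˡ (in-lineAs N₂≉0)
    ... | yes N₂≈0 | no N₁≉0  = Anyₚ.++⁺ʳ _ (in-lineBs N₂≈0 N₁≉0)
    ... | yes N₂≈0 | yes N₁≈0 = ⊥-elim (proj₁ (proj₂ (proj₂ ea)) (is-axis N₁≈0 N₂≈0))

  EALines-complete : ∀ t {u w} → IsEALine (u , w) → (u , w) ⊆π Osc t → Any ((u , w) ≗ℓ_) (EALines t)
  EALines-complete t ea (u∈ , w∈) = EALinesComplete.∈EALines t ea u∈ w∈

  ∼-sym : ∀ {u w} → NonZeroV w → u ∼ w → w ∼ u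
  ∼-sym w≉0 (a , w≈au) = inv a a≉0 , ·-invert w≈au a≉0
    where a≉0 = nonzero-multiple⇒≉0 w≉0 w≈au

  -- Every Γ-plane contains the axis, so a point off it lies on at most one of them.
  off-axis∈Osc⇒≈ₚ : ∀ t t′ a b → embed t′ (v3 a b 1#) ∈π Osc t → t ≈ₚ t′
  off-axis∈Osc⇒≈ₚ (just τ) (just τ′) a b ∈Osc = just (sym (cube-injective (x∙y⁻¹≈ε⇒x≈y _ _ (trans (solve 4 (λ τ τ′ a b →
      τ′ :* τ′ :* τ′ :- τ :* τ :* τ := :1 :* (τ′ :* τ′ :* τ′ :* :1) :+ (:- ((:1 :+ :1 :+ :1) :* τ)) :* a
      :+ ((:1 :+ :1 :+ :1) :* (τ :* τ)) :* b :+ (:- (τ :* τ :* τ)) :* :1) refl τ τ′ a b) ∈Osc))))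
  off-axis∈Osc⇒≈ₚ (just τ) nothing a b ∈Osc = ⊥-elim (1≉0 (trans (solve 3 (λ τ a b → :1 := :1 :* :1
      :+ (:- ((:1 :+ :1 :+ :1) :* τ)) :* a :+ ((:1 :+ :1 :+ :1) :* (τ :* τ)) :* b :+ (:- (τ :* τ :* τ)) :* :0) refl τ a b) ∈Osc))
  off-axis∈Osc⇒≈ₚ nothing (just τ′) a b ∈Osc = ⊥-elim (1≉0 (trans (solve 3 (λ τ a b → :1 := :0 :* (τ :* τ :* τ :* :1)
      :+ :0 :* a :+ :0 :* b :+ :1 :* :1) refl τ′ a b) ∈Osc))
  off-axis∈Osc⇒≈ₚ nothing nothing a b ∈Osc = nothing

  EALineIn⇒one-Γ-plane : ∀ t {L} → EALineIn t L → ΓPlanesThrough L 1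
  EALineIn⇒one-Γ-plane t {u , w} (_ , L⊆ , a , b , w≡) = HasCount-singleton (Osc-isΓ t , L⊆) Γ∼Osc
    where
    open Counting _∼_
    Γ∼Osc : ∀ cf → IsΓ cf × ((u , w) ⊆π cf) → cf ∼ Osc t
    Γ∼Osc cf ((isPlane , t′ , Osc∼cf) , _ , w∈cf) = k , ≈v-trans (Osc-cong (≈ₚ-sym t′≈t)) Osc≈
      where
      cf∼Osc = ∼-sym isPlane Osc∼cf
      k = proj₁ cf∼Osc
      Osc≈ = proj₂ cf∼Osc
      t′≈t = off-axis∈Osc⇒≈ₚ t′ t a b (≡.subst (_∈π Osc t′) w≡ (∈π-∼ cf∼Osc w∈cf))

  EALineIn-Γ-plane-unique : ∀ {t t′ L L′} → EALineIn t L → EALineIn t′ L′ → L ≗ℓ L′ → t ≈ₚ t′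
  EALineIn-Γ-plane-unique {t} (_ , (u∈ , w∈) , _) (_ , _ , a , b , w′≡) (_ , w′∈L , _) =
    off-axis∈Osc⇒≈ₚ _ _ a b (≡.subst (_∈π Osc t) w′≡ (∈ℓ⇒∈π u∈ w∈ w′∈L))

  Γ-plane-containing : ∀ z → ¬ ((x0 z ≈ 0#) × (x3 z ≈ 0#)) →
                       ∃[ t ] (∀ v → x3 z * x0 v - x0 z * x3 v ≈ 0# → v ∈π Osc t)
  Γ-plane-containing z z≉0 with ThroughAxis⇒Γ cf isPlane (refl , refl)
    where
    cf = v4 (x3 z) 0# 0# (- x0 z)
    isPlane : IsPlane cf
    isPlane (x3≈0 , _ , _ , -x0≈0) = z≉0 (-x≈0⇒x≈0 -x0≈0 , x3≈0)
  ... | isPlane , t , Osc∼cf = t , λ v v⊥ → ∈π-∼ (∼-sym isPlane Osc∼cf) (trans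
    (solve 6 (λ z0 z3 v0 v1 v2 v3 → z3 :* v0 :+ :0 :* v1 :+ :0 :* v2 :+ (:- z0) :* v3 := z3 :* v0 :- z0 :* v3)
      refl (x0 z) (x3 z) (x0 v) (x1 v) (x2 v) (x3 v)) v⊥)

  meets-axis⇒det≈0 : ∀ {u w X} → IsPoint X → X ∈ℓ (u , w) → X ∈ℓ axis → x0 u * x3 w - x3 u * x0 w ≈ 0#
  meets-axis⇒det≈0 {u} {w} {X} X≉0 (γ , δ , X≈) (α , β , X∈axis) with x0 u * x3 w - x3 u * x0 w ≟ 0#
  ... | yes D≈0 = D≈0
  ... | no  D≉0 = ⊥-elim (X≉0 (≈v-trans X≈ (z (x0 u) (x0 w) , z (x1 u) (x1 w) , z (x2 u) (x2 w) , z (x3 u) (x3 w))))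
    where
    D = x0 u * x3 w - x3 u * x0 w
    X₀≈0 : γ * x0 u + δ * x0 w ≈ 0#
    X₀≈0 = trans (sym (proj₁ X≈)) (trans (proj₁ X∈axis) (sym (proj₁ (axis-combination α β))))
    X₃≈0 : γ * x3 u + δ * x3 w ≈ 0#
    X₃≈0 = trans (sym (proj₂ (proj₂ (proj₂ X≈))))
                 (trans (proj₂ (proj₂ (proj₂ X∈axis))) (sym (proj₁ (axis-combination α β))))
    γ≈0 : γ ≈ 0#
    γ≈0 = x*y≈0⇒y≈0 D≉0 (trans (*-comm D γ) (zero-combination₂ (x3 w) (- x0 w) (solve 6 (λ γ δ u0 u3 w0 w3 →
      γ :* (u0 :* w3 :- u3 :* w0) := w3 :* (γ :* u0 :+ δ :* w0) :+ (:- w0) :* (γ :* u3 :+ δ :* w3))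
      refl γ δ (x0 u) (x3 u) (x0 w) (x3 w)) X₀≈0 X₃≈0))
    δ≈0 : δ ≈ 0#
    δ≈0 = x*y≈0⇒y≈0 D≉0 (trans (*-comm D δ) (zero-combination₂ (x0 u) (- x3 u) (solve 6 (λ γ δ u0 u3 w0 w3 →
      δ :* (u0 :* w3 :- u3 :* w0) := u0 :* (γ :* u3 :+ δ :* w3) :+ (:- u3) :* (γ :* u0 :+ δ :* w0))
      refl γ δ (x0 u) (x3 u) (x0 w) (x3 w)) X₃≈0 X₀≈0))
    z : ∀ a b → γ * a + δ * b ≈ 0#
    z a b = trans (+-cong (trans (*-congʳ γ≈0) (zeroˡ a)) (trans (*-congʳ δ≈0) (zeroˡ b))) (+-identityˡ 0#)

  self-⊥ : ∀ z → x3 z * x0 z - x0 z * x3 z ≈ 0#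
  self-⊥ z = solve 2 (λ z0 z3 → z3 :* z0 :- z0 :* z3 := :0) refl (x0 z) (x3 z)

  off-axis⇒Γ-plane : ∀ z → (x0 z ≈ 0# × x3 z ≈ 0#) ⊎ ∃[ t ] (∀ v → x3 z * x0 v - x0 z * x3 v ≈ 0# → v ∈π Osc t)
  off-axis⇒Γ-plane z with x0 z ≟ 0# | x3 z ≟ 0#
  ... | yes x0≈0 | yes x3≈0 = inj₁ (x0≈0 , x3≈0)
  ... | no  x0≉0 | _         = inj₂ (Γ-plane-containing z (λ (x0≈0 , _) → x0≉0 x0≈0))
  ... | yes _    | no  x3≉0  = inj₂ (Γ-plane-containing z (λ (_ , x3≈0) → x3≉0 x3≈0))

  on-axis : ∀ z → x0 z ≈ 0# → x3 z ≈ 0# → z ∈ℓ axis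
  on-axis z x0≈0 x3≈0 with axis-combination (x1 z) (x2 z)
  ... | 0≈ , y1≈ , y2≈ = x1 z , x2 z , trans x0≈0 0≈ , y1≈ , y2≈ , trans x3≈0 0≈

  -- An EA-line meets the axis x₀ = x₃ = 0, so the (x₀, x₃)-parts of its spanning vectors
  -- are proportional; the Γ-plane through the axis and one of them contains the line.
  EALine⇒Γ-plane : ∀ {u w} → IsEALine (u , w) → ∃[ t ] ((u , w) ⊆π Osc t)
  EALine⇒Γ-plane {u} {w} (ind , _ , L≢axis , X , X≉0 , X∈L , X∈axis)
    with off-axis⇒Γ-plane u | off-axis⇒Γ-plane w | meets-axis⇒det≈0 X≉0 X∈L X∈axis
  ... | inj₂ (t , ⊆Osc) | _ | D≈0 = t , ⊆Osc u (self-⊥ u) , ⊆Osc w (zero-combination₁ (- 1#) (solve 4 (λ u0 u3 w0 w3 →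
        u3 :* w0 :- u0 :* w3 := (:- :1) :* (u0 :* w3 :- u3 :* w0)) refl (x0 u) (x3 u) (x0 w) (x3 w)) D≈0)
  ... | inj₁ _ | inj₂ (t , ⊆Osc) | D≈0 = t , ⊆Osc u (zero-combination₁ 1# (solve 4 (λ u0 u3 w0 w3 →
        w3 :* u0 :- w0 :* u3 := :1 :* (u0 :* w3 :- u3 :* w0)) refl (x0 u) (x3 u) (x0 w) (x3 w)) D≈0) , ⊆Osc w (self-⊥ w)
  ... | inj₁ (u0≈0 , u3≈0) | inj₁ (w0≈0 , w3≈0) | _ =
    ⊥-elim (L≢axis (proj₁ exchanged , proj₂ exchanged , u∈axis , w∈axis))
    where
    u∈axis = on-axis u u0≈0 u3≈0
    w∈axis = on-axis w w0≈0 w3≈0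
    exchanged = span-exchange ind u∈axis w∈axis

  -- The counts Λ and Π

  params : List Param
  params = map just elements ++ nothing ∷ []

  ∈-params : ∀ t → Any (t ≈ₚ_) params
  ∈-params (just x) = Anyₚ.++⁺ˡ (Anyₚ.map⁺ (Any.map just (complete x)))
  ∈-params nothing  = Anyₚ.++⁺ʳ (map just elements) (here nothing)

  params-unique : AllPairs (λ t t′ → ¬ t ≈ₚ t′) params
  params-unique = AllPairsₚ.++⁺
    (AllPairsₚ.map⁺ (AllPairs.map (λ { x≉y (just x≈y) → x≉y x≈y }) distinct)) ([] ∷ [])
    (Allₚ.map⁺ (All.universal (λ _ → (λ ()) ∷ []) elements))

  length-params : length params ≡ q ℕ.+ 1
  length-params = ≡.trans (List.length-++ (map just elements)) (≡.cong (ℕ._+ 1) (List.length-map just elements))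

  allEALines : List LinePair
  allEALines = concat (map EALines params)

  allEALines-enumerate : Enumerates _≗ℓ_ IsEALine allEALines
  allEALines-enumerate =
    Allₚ.concat⁺ (Allₚ.map⁺ (All.universal (λ t → All.map proj₁ (EALines-EA t)) params)) ,
    AllPairsₚ.concat⁺ (Allₚ.map⁺ (All.universal EALines-unique params)) different-planes ,
    ∈allEALines
    where
    different-planes : AllPairs (λ Ls Ls′ → All (λ L → All (L ≢ℓ_) Ls′) Ls) (map EALines params)
    different-planes = AllPairsₚ.map⁺ (AllPairs.map (λ t≉t′ → All.map (λ inL → All.map
      (λ inL′ L≗L′ → t≉t′ (EALineIn-Γ-plane-unique inL inL′ L≗L′)) (EALines-EA _)) (EALines-EA _)) params-unique)
    ∈allEALines : ∀ L → IsEALine L → Any (L ≗ℓ_) allEALines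
    ∈allEALines (u , w) ea with EALine⇒Γ-plane ea
    ... | t , (u∈ , w∈) = Anyₚ.concat⁺ (Anyₚ.map⁺ (Any.map (λ t≈t′ →
      EALines-complete _ ea (∈π-respʳ (Osc-cong t≈t′) u∈ , ∈π-respʳ (Osc-cong t≈t′) w∈)) (∈-params t)))

  length-allEALines : length allEALines ≡ (q ℕ.+ 1) ℕ.* (q ℕ.* q ℕ.∸ 1)
  length-allEALines =
    ≡.trans (length-concat-map EALines length-EALines params) (≡.cong (ℕ._* (q ℕ.* q ℕ.∸ 1)) length-params)

  EA-Γ-average : ΠΓ IsEALine 1
  EA-Γ-average = AverageIs-constant 1 allEALines-enumerate
    (λ |all|≡0 → [q+1][q²-1]≢0 order≥2 (≡.trans (≡.sym length-allEALines) |all|≡0))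
    (Allₚ.concat⁺ (Allₚ.map⁺ (All.universal (λ t → All.map (EALineIn⇒one-Γ-plane t) (EALines-EA t)) params)))
    where
    open Counting _≗ℓ_
    [q+1][q²-1]≢0 : ∀ {n} → 2 ℕ.≤ n → ¬ (n ℕ.+ 1) ℕ.* (n ℕ.* n ℕ.∸ 1) ≡ 0
    [q+1][q²-1]≢0 (s≤s (s≤s _)) ()

  Γ-plane-EA-lines : ∀ cf → IsΓ cf → LinesInPlane IsEALine cf (q ℕ.* q ℕ.∸ 1)
  Γ-plane-EA-lines cf (isPlane , t , Osc∼cf) =
    EALines t , (All.map in-cf (EALines-EA t) , EALines-unique t , ∈EALines) , length-EALines t
    where
    in-cf : ∀ {L} → EALineIn t L → IsEALine L × (L ⊆π cf)
    in-cf (ea , (u∈ , w∈) , _) = ea , ∈π-∼ Osc∼cf u∈ , ∈π-∼ Osc∼cf w∈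
    ∈EALines : ∀ L → IsEALine L × (L ⊆π cf) → Any (L ≗ℓ_) (EALines t)
    ∈EALines _ (ea , u∈ , w∈) =
      EALines-complete t ea (∈π-∼ (∼-sym isPlane Osc∼cf) u∈ , ∈π-∼ (∼-sym isPlane Osc∼cf) w∈)

  axis-isALine : IsALine axis
  axis-isALine = independent , ∈ℓ-first _ _ , ∈ℓ-second _ _ , ∈ℓ-first _ _ , ∈ℓ-second _ _
    where
    independent : IsLine axis
    independent α β (_ , e₁ , e₂ , _) = trans (proj₁ (proj₂ (axis-combination α β))) e₁ ,
                                        trans (proj₂ (proj₂ (axis-combination α β))) e₂

  Γ⇒axis⊆π : ∀ cf → IsΓ cf → axis ⊆π cf
  Γ⇒axis⊆π cf Γ = ThroughAxis⇒axis⊆π cf (Γ⇒ThroughAxis cf Γ)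

  Γ-plane-A-lines : ∀ cf → IsΓ cf → LinesInPlane IsALine cf 1
  Γ-plane-A-lines cf Γ = HasCount-singleton (axis-isALine , Γ⇒axis⊆π cf Γ) (λ _ ((_ , L≗) , _) → L≗)
    where open Counting _≗ℓ_

  ΓPlanesThrough-axis : ΓPlanesThrough axis (q ℕ.+ 1)
  ΓPlanesThrough-axis = map Osc params ,
    (Allₚ.map⁺ (All.universal (λ t → Osc-isΓ t , Γ⇒axis⊆π (Osc t) (Osc-isΓ t)) params) ,
     AllPairsₚ.map⁺ (AllPairs.map (λ t≉t′ Osc≈ → t≉t′ (Osc-injective _ _ Osc≈)) params-unique) ,
     ∈Osc-params) ,
    ≡.trans (List.length-map Osc params) length-params
    where
    ∈Osc-params : ∀ cf → IsΓ cf × (axis ⊆π cf) → Any (cf ∼_) (map Osc params)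
    ∈Osc-params cf ((isPlane , t , Osc∼cf) , _) = Anyₚ.map⁺ (Any.map (λ t≈t′ →
      proj₁ cf∼Osc , ≈v-trans (Osc-cong (≈ₚ-sym t≈t′)) (proj₂ cf∼Osc)) (∈-params t))
      where cf∼Osc = ∼-sym isPlane Osc∼cf

  A-Γ-average : ΠΓ IsALine (q ℕ.+ 1)
  A-Γ-average = AverageIs-constant (q ℕ.+ 1) ((axis-isALine ∷ []) , ([] ∷ []) , λ _ (_ , L≗) → here L≗) (λ ())
                  (ΓPlanesThrough-axis ∷ [])
    where open Counting _≗ℓ_

open import Data.Nat using (_^_; _≤_; _∸_; _*_; _+_)

theorem6p1 : ∀ {c ℓ : Level} (F : FiniteField c ℓ) →
    let open Geometry F in
    (∃[ k ] (q ≡ 3 ^ k)) → 5 ≤ q →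
      -- every Γ-plane contains the axis A
      (∀ cf → IsΓ cf → axis ⊆π cf)
      -- Λ_{A,Γ} = 1
      × (∀ cf → IsΓ cf → LinesInPlane IsALine cf 1)
      -- Π_{Γ,A} = q + 1
      × ΠΓ IsALine (q + 1)
      -- A lies in no 2_C-, 3_C-, \overline{1_C}- or 0_C-plane
      × (∀ cf → axis ⊆π cf →
           ¬ IsdC 2 cf × ¬ IsdC 3 cf × ¬ Is1barC cf × ¬ IsdC 0 cf)
      -- Λ_{EA,Γ} = q^2 - 1
      × (∀ cf → IsΓ cf → LinesInPlane IsEALine cf (q * q ∸ 1))
      -- Π_{Γ,EA} = 1
      × ΠΓ IsEALine 1
theorem6p1 F q≡3^k _ =
  Γ⇒axis⊆π , Γ-plane-A-lines , A-Γ-average , planes-through-axis , Γ-plane-EA-lines , EA-Γ-average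
  where open Char3Geometry F (FiniteFieldProperties.characteristic-three F q≡3^k)
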